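{- Let $\mathbf{x}$ be a set of indeterminates, $\gamma$ a further indeterminate, and $[A_{n,k}]_{n,k\ge0}$ an array with entries in $\mathbb{R}[\mathbf{x}]$. Define its $\gamma$-binomial transformation $A^\circ_{n,k}=\sum_{i=0}^n\binom{n}{i}A_{i,k}\gamma^{n-i}$, and write $A_n(q)=\sum_kA_{n,k}q^k$, $A^\circ_n(q)=\sum_kA^\circ_{n,k}q^k$. Then: (i) if $[A_{n,k}]$ is $\mathbf{x}$-TP$_r$, then $[A^\circ_{n,k}]$ is $(\mathbf{x},\gamma)$-TP$_r$; (ii) $A^\circ_n(q)=\sum_{i=0}^n\binom{n}{i}A_i(q)\gamma^{n-i}$ for all $n\ge0$; (iii) if $A_{0,0}=1$, $A_{n,k}=0$ unless $0\le k\le n$, and $A_{n,k}=r_{k-1}(\mathbf{x})A_{n-1,k-1}+s_k(\mathbf{x})A_{n-1,k}+t_{k+1}(\mathbf{x})A_{n-1,k+1}$ for $n\ge1$ (with $r_n,s_n,t_n\in\mathbb{R}[\mathbf{x}]$), then $A^\circ_{0,0}=1$, $A^\circ_{n,k}=0$ unless $0\le k\le n$, and $A^\circ_{n,k}=r_{k-1}(\mathbf{x})A^\circ_{n-1,k-1}+(\gamma+s_k(\mathbf{x}))A^\circ_{n-1,k}+t_{k+1}(\mathbf{x})A^\circ_{n-1,k+1}$ for $n\ge1$; (iv) if $(A_{n,0})_{n\ge0}$ is an $\mathbf{x}$-Stieltjes moment sequence, then $(A^\circ_{n,0})_{n\ge0}$ is an $(\mathbf{x},\gamma)$-Stieltjes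 moment sequence.
   Context: For indeterminates $\mathbf{y}$, a matrix is $\mathbf{y}$-TP$_r$ if all its minors of order $\le r$ are polynomials in $\mathbf{y}$ with nonnegative coefficients, and $\mathbf{y}$-TP if all its minors are. A sequence $(\alpha_n)$ is a $\mathbf{y}$-Stieltjes moment sequence if its Hankel matrix $[\alpha_{i+j}]_{i,j\ge0}$ is $\mathbf{y}$-TP. -}

module Defs where

open import Level using (Level; _⊔_)
open import Data.Nat as ℕ using (ℕ; zero; suc; _∸_)
open import Data.Nat.Combinatorics using (_C_)
open import Data.Bool using (Bool; true; false; if_then_else_; _∧_)
open import Data.List as List using (List; []; _∷_; upTo; map; foldr; concatMap; drop; length)
open import Data.Nat.ListAction using (sum)
open import Data.List.Relation.Unary.All using (All)
open import Data.Fin as Fin using (Fin; punchIn)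
import Data.Fin as F
open import Data.Product using (_×_; Σ; ∃)
open import Relation.Binary.PropositionalEquality using (_≡_)
open import Relation.Binary.Structures using (IsTotalOrder)
open import Relation.Nullary using (¬_)
open import Algebra.Bundles using (CommutativeRing)

-- Ordered commutative rings (stand-in for ℝ; ℝ is an instance).

record OrderedCommutativeRing (c ℓ₁ ℓ₂ : Level) : Set (Level.suc (c ⊔ ℓ₁ ⊔ ℓ₂)) where
  field
    commutativeRing : CommutativeRing c ℓ₁
  open CommutativeRing commutativeRing public
  infix 4 _≤_
  field
    _≤_          : Carrier → Carrier → Set ℓ₂
    isTotalOrder : IsTotalOrder _≈_ _≤_
    +-monoˡ-≤    : ∀ {x y} z → x ≤ y → (x + z) ≤ (y + z)
    0≤-*         : ∀ {x y} → 0# ≤ x → 0# ≤ y → 0# ≤ (x * y)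

-- Monomials in the countably many indeterminates y₀, y₁, y₂, …:
-- a monomial is a finite list of exponents (position i = exponent of yᵢ),
-- identified up to trailing zeros.
-- Convention: y₀ = γ, and y₍ᵢ₊₁₎ = xᵢ.

Mon : Set
Mon = List ℕ

allZero : Mon → Bool
allZero []          = true
allZero (zero ∷ m)  = allZero m
allZero (suc _ ∷ m) = false

isVar : ℕ → Mon → Bool
isVar zero    (1 ∷ m)    = allZero m
isVar zero    _          = false
isVar (suc i) (zero ∷ m) = isVar i m
isVar (suc i) _          = false

below : Mon → List Mon
below []      = [] ∷ []
below (e ∷ m) = concatMap (λ i → map (i ∷_) (below m)) (upTo (suc e))

_∸ₘ_ : Mon → Mon → Mon
[]      ∸ₘ _       = []
(e ∷ m) ∸ₘ []      = e ∷ m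
(e ∷ m) ∸ₘ (a ∷ b) = (e ∸ a) ∷ (m ∸ₘ b)

data IsZeroℕ : ℕ → Set where
  isZero : IsZeroℕ 0

module PolyDefs {c ℓ₁ ℓ₂} (R : OrderedCommutativeRing c ℓ₁ ℓ₂) where
  open OrderedCommutativeRing R

  Poly : Set c
  Poly = Mon → Carrier

  IsPoly : Poly → Set ℓ₁
  IsPoly p = (∀ m → p (m List.++ (0 ∷ [])) ≈ p m)
           × ∃ λ (N : ℕ) → ∀ m → ¬ (p m ≈ 0#) → (sum m ℕ.≤ N) × All IsZeroℕ (drop N m)

  -- p ∈ R[x]: p is a polynomial not involving γ = y₀
  InRx : Poly → Set ℓ₁
  InRx p = IsPoly p × (∀ e m → p (suc e ∷ m) ≈ 0#)

  infix 4 _≈ₚ_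
  _≈ₚ_ : Poly → Poly → Set ℓ₁
  p ≈ₚ q = ∀ m → p m ≈ q m

  NonNeg : Poly → Set ℓ₂
  NonNeg p = ∀ m → 0# ≤ p m

  0ₚ 1ₚ γ : Poly
  0ₚ m = 0#
  1ₚ m = if allZero m then 1# else 0#
  γ m  = if isVar 0 m then 1# else 0#

  infixl 6 _+ₚ_
  infixl 7 _*ₚ_
  _+ₚ_ : Poly → Poly → Poly
  (p +ₚ q) m = p m + q m

  -ₚ_ : Poly → Poly
  (-ₚ p) m = - (p m)

  _*ₚ_ : Poly → Poly → Poly
  (p *ₚ q) m = foldr (λ a acc → p a * q (m ∸ₘ a) + acc) 0# (below m)

  fromℕₚ : ℕ → Poly
  fromℕₚ zero    = 0ₚ
  fromℕₚ (suc n) = 1ₚ +ₚ fromℕₚ n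

  _^ₚ_ : Poly → ℕ → Poly
  p ^ₚ zero  = 1ₚ
  p ^ₚ suc n = p *ₚ (p ^ₚ n)

  sumTo : ℕ → (ℕ → Poly) → Poly
  sumTo n f = foldr (λ i acc → f i +ₚ acc) 0ₚ (upTo (suc n))

  sumFin : ∀ {m} → (Fin m → Poly) → Poly
  sumFin {zero}  f = 0ₚ
  sumFin {suc m} f = f F.zero +ₚ sumFin (λ j → f (F.suc j))

  sign : ℕ → Poly
  sign zero    = 1ₚ
  sign (suc j) = -ₚ sign j

  det : ∀ {m} → (Fin m → Fin m → Poly) → Poly
  det {zero}  M = 1ₚ
  det {suc m} M = sumFin λ j →
    sign (F.toℕ j) *ₚ M F.zero j *ₚ det (λ i k → M (F.suc i) (punchIn j k))

  Array : Set c
  Array = ℕ → ℕ → Poly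

  StrictlyIncreasing : ∀ {m} → (Fin m → ℕ) → Set
  StrictlyIncreasing f = ∀ i j → i F.< j → f i ℕ.< f j

  minor : Array → ∀ {m} → (Fin m → ℕ) → (Fin m → ℕ) → Poly
  minor A rows cols = det (λ i j → A (rows i) (cols j))

  TPr : ℕ → Array → Set ℓ₂
  TPr r A = ∀ m → m ℕ.≤ r → (rows cols : Fin m → ℕ) →
            StrictlyIncreasing rows → StrictlyIncreasing cols →
            NonNeg (minor A rows cols)

  TP : Array → Set ℓ₂
  TP A = ∀ m → (rows cols : Fin m → ℕ) →
         StrictlyIncreasing rows → StrictlyIncreasing cols →
         NonNeg (minor A rows cols)

  Hankel : (ℕ → Poly) → Array
  Hankel a i j = a (i ℕ.+ j)

  Stieltjes : (ℕ → Poly) → Set ℓ₂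
  Stieltjes a = TP (Hankel a)

  binomialTransform : Array → Array
  binomialTransform A n k = sumTo n λ i → fromℕₚ (n C i) *ₚ A i k *ₚ (γ ^ₚ (n ∸ i))

  -- row generating functions A_n(q) = Σ_k A_{n,k} q^k, as formal power
  -- series in q with coefficients in R[x,γ] (coefficient sequences)
  QSeries : Set c
  QSeries = ℕ → Poly

  rowGF : Array → ℕ → QSeries
  rowGF A n k = A n k

  _·ₛ_ : Poly → QSeries → QSeries
  (p ·ₛ f) k = p *ₚ f k

  sumToₛ : ℕ → (ℕ → QSeries) → QSeries
  sumToₛ n F k = sumTo n λ i → F i k

  _≈ₛ_ : QSeries → QSeries → Set ℓ₁
  f ≈ₛ g = ∀ k → f k ≈ₚ g k

  -- tridiagonal recurrence with coefficients r, s, t; the term with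
  -- index k-1 is absent for k = 0 (A_{n,-1} = 0)
  triStep : (ℕ → Poly) → (ℕ → Poly) → (ℕ → Poly) → Array → ℕ → ℕ → Poly
  triStep r s t A n zero    = s 0 *ₚ A n 0 +ₚ t 1 *ₚ A n 1
  triStep r s t A n (suc k) =
    r k *ₚ A n k +ₚ s (suc k) *ₚ A n (suc k) +ₚ t (suc (suc k)) *ₚ A n (suc (suc k))

  TriRec : (ℕ → Poly) → (ℕ → Poly) → (ℕ → Poly) → Array → Set ℓ₁
  TriRec r s t A = ∀ n k → A (suc n) k ≈ₚ triStep r s t A n k

  LowerUnit : Array → Set ℓ₁
  LowerUnit A = (A 0 0 ≈ₚ 1ₚ) × (∀ n k → n ℕ.< k → A n k ≈ₚ 0ₚ)

-- The γ-binomial transform is left multiplication by the lower triangular matrix P = [C(n,i) γ^(n-i)].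
-- By Pascal's rule, the rows n ≤ K of P are those of a product of K unit lower bidiagonal matrices
-- whose subdiagonal entries are γ or 0. Multiplying by such a matrix preserves TP_r: by
-- multilinearity each new minor is a nonnegative combination of old minors and of minors with two
-- equal adjacent rows, which vanish. For (iv), the Hankel matrix of (A°ₙ₀) is P H Pᵀ, where H is the
-- Hankel matrix of (Aₙ₀), so the argument applies to rows and then to columns. Parts (ii) and (iii)
-- are direct computations, (iii) again by Pascal's rule.
module Submission where

open import Defs
open import Data.Nat using (ℕ; _∸_)
open import Data.Nat.Combinatorics using (_C_)
open import Data.Product using (_×_)

open import Algebra.Bundles using (CommutativeRing)
open import Algebra.Structures using (IsCommutativeRing)
import Algebra.Construct.Pointwise as Pointwise
import Algebra.Consequences.Setoid as Consequences
open import Data.Bool using (true; false)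
open import Data.Nat as ℕ using (zero; suc; z≤n; s≤s; z<s; s<s; _<?_; _≤?_)
import Data.Nat.Properties as ℕ
open import Data.Nat.Combinatorics using (nCk+nC[k+1]≡[n+1]C[k+1]; k>n⇒nCk≡0)
open import Data.Fin as Fin using (Fin; zero; suc; toℕ; opposite; punchIn; punchOut; inject₁)
import Data.Fin.Properties as Fin
import Data.Fin.Permutation as Perm
open import Data.List using (List; []; _∷_; _++_; map; foldr; concatMap; applyUpTo)
open import Data.List.Properties using (foldr-map)
open import Data.Product using (_,_)
open import Data.Sum using (_⊎_; inj₁; inj₂)
open import Data.Vec.Functional using (updateAt)
open import Data.Vec.Functional.Properties using (updateAt-updates; updateAt-minimal)
open import Function using (_∘_; flip)
open import Relation.Binary.Bundles using (Setoid)
open import Relation.Binary.Structures using (IsTotalOrder)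
open import Relation.Nullary using (yes; no; ¬_; contradiction)
open import Relation.Binary.PropositionalEquality as ≡ using (_≡_; _≢_)

module RangeSum {c ℓ} (R : CommutativeRing c ℓ) where
  open import Data.Nat using (_<_)
  open CommutativeRing R
  open import Algebra.Properties.Semiring.Sum semiring
  open import Relation.Binary.Reasoning.Setoid setoid

  ∑ℕ : ℕ → (ℕ → Carrier) → Carrier
  ∑ℕ n f = ∑[ i < n ] f (toℕ i)

  ∑ℕ-cong-< : ∀ n {f g} → (∀ i → i < n → f i ≈ g i) → ∑ℕ n f ≈ ∑ℕ n g
  ∑ℕ-cong-< n f≈g = sum-cong-≋ (λ i → f≈g (toℕ i) (Fin.toℕ<n i))

  ∑ℕ-cong : ∀ n {f g} → (∀ i → f i ≈ g i) → ∑ℕ n f ≈ ∑ℕ n g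
  ∑ℕ-cong n f≈g = ∑ℕ-cong-< n (λ i _ → f≈g i)

  ∑ℕ-zero : ∀ n {f} → (∀ i → i < n → f i ≈ 0#) → ∑ℕ n f ≈ 0#
  ∑ℕ-zero n f≈0 = trans (∑ℕ-cong-< n f≈0) (sum-replicate-zero n)

  ∑ℕ-distrib-+ : ∀ n f g → ∑ℕ n (λ i → f i + g i) ≈ ∑ℕ n f + ∑ℕ n g
  ∑ℕ-distrib-+ n f g = ∑-distrib-+ {n} (f ∘ toℕ) (g ∘ toℕ)

  *-distribˡ-∑ℕ : ∀ n x f → x * ∑ℕ n f ≈ ∑ℕ n (λ i → x * f i)
  *-distribˡ-∑ℕ n x f = *-distribˡ-sum {n} x (f ∘ toℕ)

  *-distribʳ-∑ℕ : ∀ n x f → ∑ℕ n f * x ≈ ∑ℕ n (λ i → f i * x)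
  *-distribʳ-∑ℕ n x f = *-distribʳ-sum {n} x (f ∘ toℕ)

  ∑ℕ-comm : ∀ m n (F : ℕ → ℕ → Carrier) →
    ∑ℕ m (λ i → ∑ℕ n (F i)) ≈ ∑ℕ n (λ j → ∑ℕ m (λ i → F i j))
  ∑ℕ-comm m n F = ∑-comm {m} {n} (λ i j → F (toℕ i) (toℕ j))

  ∑ℕ-init-last : ∀ n f → ∑ℕ (suc n) f ≈ ∑ℕ n f + f n
  ∑ℕ-init-last n f = trans (sum-init-last {n} (f ∘ toℕ))
    (+-cong (reflexive (sum-cong-≗ {n} (λ i → ≡.cong f (Fin.toℕ-inject₁ i))))
            (reflexive (≡.cong f (Fin.toℕ-fromℕ n))))

  ∑ℕ-reflect : ∀ n (G : ℕ → ℕ → Carrier) →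
    ∑ℕ (suc n) (λ i → G i (n ∸ i)) ≈ ∑ℕ (suc n) (λ i → G (n ∸ i) i)
  ∑ℕ-reflect n G = trans (∑-permute {suc n} (λ i → G (toℕ i) (n ∸ toℕ i)) Perm.reverse)
    (reflexive (sum-cong-≗ {suc n} reflected))
    where
    reflected : ∀ i → G (toℕ (opposite i)) (n ∸ toℕ (opposite i)) ≡ G (n ∸ toℕ i) (toℕ i)
    reflected i rewrite Fin.opposite-prop i =
      ≡.cong (G (n ∸ toℕ i)) (ℕ.m∸[m∸n]≡n (ℕ.s≤s⁻¹ (Fin.toℕ<n i)))

  ∑ℕ-triangle : ∀ e (G : ℕ → ℕ → ℕ → Carrier) →
    ∑ℕ (suc e) (λ i → ∑ℕ (suc i) (λ j → G j (i ∸ j) (e ∸ i)))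
      ≈ ∑ℕ (suc e) (λ j → ∑ℕ (suc (e ∸ j)) (λ k → G j k (e ∸ j ∸ k)))
  ∑ℕ-triangle zero    G = refl
  ∑ℕ-triangle (suc e) G = begin
    (G 0 0 (suc e) + 0#) + ∑ℕ (suc e) (λ i → G 0 (suc i) (e ∸ i) + T i)
      ≈⟨ +-cong (+-identityʳ _) (∑ℕ-distrib-+ (suc e) (λ i → G 0 (suc i) (e ∸ i)) T) ⟩
    G 0 0 (suc e) + (∑ℕ (suc e) (λ i → G 0 (suc i) (e ∸ i)) + ∑ℕ (suc e) T)
      ≈⟨ +-assoc _ _ _ ⟨
    (G 0 0 (suc e) + ∑ℕ (suc e) (λ i → G 0 (suc i) (e ∸ i))) + ∑ℕ (suc e) T
      ≈⟨ +-congˡ (∑ℕ-triangle e (G ∘ suc)) ⟩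
    (G 0 0 (suc e) + ∑ℕ (suc e) (λ i → G 0 (suc i) (e ∸ i)))
      + ∑ℕ (suc e) (λ j → ∑ℕ (suc (e ∸ j)) (λ k → G (suc j) k (e ∸ j ∸ k))) ∎
    where
    T : ℕ → Carrier
    T i = ∑ℕ (suc i) (λ j → G (suc j) (i ∸ j) (e ∸ i))

module PolynomialRing {c ℓ₁ ℓ₂} (R : OrderedCommutativeRing c ℓ₁ ℓ₂) where
  open OrderedCommutativeRing R
  open PolyDefs R
  open RangeSum commutativeRing
  open import Relation.Binary.Reasoning.Setoid setoid

  listSum : (Mon → Carrier) → List Mon → Carrier
  listSum h = foldr (λ a acc → h a + acc) 0#

  listSum-++ : ∀ h xs ys → listSum h (xs ++ ys) ≈ listSum h xs + listSum h ys
  listSum-++ h []       ys = sym (+-identityˡ _)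
  listSum-++ h (x ∷ xs) ys = trans (+-congˡ (listSum-++ h xs ys)) (sym (+-assoc _ _ _))

  listSum-concatMap : ∀ h (F : ℕ → List Mon) g n →
    listSum h (concatMap F (applyUpTo g n)) ≈ ∑ℕ n (λ i → listSum h (F (g i)))
  listSum-concatMap h F g zero    = refl
  listSum-concatMap h F g (suc n) =
    trans (listSum-++ h (F (g 0)) _) (+-congˡ (listSum-concatMap h F (g ∘ suc) n))

  ∑below : Mon → (Mon → Carrier) → Carrier
  ∑below []      f = f []
  ∑below (e ∷ m) f = ∑ℕ (suc e) (λ i → ∑below m (λ a → f (i ∷ a)))

  listSum-below : ∀ m h → listSum h (below m) ≈ ∑below m h
  listSum-below []      h = +-identityʳ _
  listSum-below (e ∷ m) h = trans (listSum-concatMap h (λ i → map (i ∷_) (below m)) (λ i → i) (suc e))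
    (∑ℕ-cong (suc e) (λ i → trans (reflexive (foldr-map (λ a acc → h a + acc) (i ∷_) 0# (below m)))
                                   (listSum-below m (λ a → h (i ∷ a)))))

  *ₚ-as-∑below : ∀ p q m → (p *ₚ q) m ≈ ∑below m (λ a → p a * q (m ∸ₘ a))
  *ₚ-as-∑below p q m = listSum-below m _

  ∑below-cong : ∀ m {f g} → (∀ a → f a ≈ g a) → ∑below m f ≈ ∑below m g
  ∑below-cong []      f≈g = f≈g []
  ∑below-cong (e ∷ m) f≈g = ∑ℕ-cong (suc e) (λ i → ∑below-cong m (λ a → f≈g (i ∷ a)))

  ∑below-distrib-+ : ∀ m f g → ∑below m (λ a → f a + g a) ≈ ∑below m f + ∑below m g
  ∑below-distrib-+ []      f g = refl
  ∑below-distrib-+ (e ∷ m) f g =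
    trans (∑ℕ-cong (suc e) (λ i → ∑below-distrib-+ m (λ a → f (i ∷ a)) (λ a → g (i ∷ a))))
          (∑ℕ-distrib-+ (suc e) (λ i → ∑below m (λ a → f (i ∷ a))) (λ i → ∑below m (λ a → g (i ∷ a))))

  *-distribˡ-∑below : ∀ m x f → x * ∑below m f ≈ ∑below m (λ a → x * f a)
  *-distribˡ-∑below []      x f = refl
  *-distribˡ-∑below (e ∷ m) x f = trans (*-distribˡ-∑ℕ (suc e) x (λ i → ∑below m (λ a → f (i ∷ a))))
    (∑ℕ-cong (suc e) (λ i → *-distribˡ-∑below m x (λ a → f (i ∷ a))))

  *-distribʳ-∑below : ∀ m x f → ∑below m f * x ≈ ∑below m (λ a → f a * x)
  *-distribʳ-∑below []      x f = refl
  *-distribʳ-∑below (e ∷ m) x f = trans (*-distribʳ-∑ℕ (suc e) x (λ i → ∑below m (λ a → f (i ∷ a))))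
    (∑ℕ-cong (suc e) (λ i → *-distribʳ-∑below m x (λ a → f (i ∷ a))))

  ∑below-zero : ∀ m → ∑below m (λ _ → 0#) ≈ 0#
  ∑below-zero []      = refl
  ∑below-zero (e ∷ m) = ∑ℕ-zero (suc e) (λ i _ → ∑below-zero m)

  ∑below-∑ℕ-comm : ∀ m n (F : ℕ → Mon → Carrier) →
    ∑below m (λ a → ∑ℕ n (λ j → F j a)) ≈ ∑ℕ n (λ j → ∑below m (F j))
  ∑below-∑ℕ-comm []      n F = refl
  ∑below-∑ℕ-comm (e ∷ m) n F =
    trans (∑ℕ-cong (suc e) (λ i → ∑below-∑ℕ-comm m n (λ j a → F j (i ∷ a))))
          (∑ℕ-comm (suc e) n (λ i j → ∑below m (λ a → F j (i ∷ a))))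

  ∑below-reflect : ∀ m (F : Mon → Mon → Carrier) →
    ∑below m (λ a → F a (m ∸ₘ a)) ≈ ∑below m (λ a → F (m ∸ₘ a) a)
  ∑below-reflect []      F = refl
  ∑below-reflect (e ∷ m) F = trans
    (∑ℕ-cong (suc e) (λ i → ∑below-reflect m (λ a b → F (i ∷ a) ((e ∸ i) ∷ b))))
    (∑ℕ-reflect e (λ i i' → ∑below m (λ a → F (i ∷ (m ∸ₘ a)) (i' ∷ a))))

  ∑below-triangle : ∀ m (H : Mon → Mon → Mon → Carrier) →
    ∑below m (λ a → ∑below a (λ b → H b (a ∸ₘ b) (m ∸ₘ a)))
      ≈ ∑below m (λ b → ∑below (m ∸ₘ b) (λ c → H b c ((m ∸ₘ b) ∸ₘ c)))
  ∑below-triangle []      H = refl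
  ∑below-triangle (e ∷ m) H = begin
    ∑ℕ (suc e) (λ i → ∑below m (λ a → ∑ℕ (suc i) (λ j → T i j a)))
      ≈⟨ ∑ℕ-cong (suc e) (λ i → ∑below-∑ℕ-comm m (suc i) (T i)) ⟩
    ∑ℕ (suc e) (λ i → ∑ℕ (suc i) (λ j → ∑below m (T i j)))
      ≈⟨ ∑ℕ-cong (suc e) (λ i → ∑ℕ-cong (suc i) (λ j →
           ∑below-triangle m (λ b c d → H (j ∷ b) ((i ∸ j) ∷ c) ((e ∸ i) ∷ d)))) ⟩
    ∑ℕ (suc e) (λ i → ∑ℕ (suc i) (λ j → G j (i ∸ j) (e ∸ i)))
      ≈⟨ ∑ℕ-triangle e G ⟩
    ∑ℕ (suc e) (λ j → ∑ℕ (suc (e ∸ j)) (λ k → G j k (e ∸ j ∸ k)))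
      ≈⟨ ∑ℕ-cong (suc e) (λ j → ∑below-∑ℕ-comm m (suc (e ∸ j)) (U j)) ⟨
    ∑ℕ (suc e) (λ j → ∑below m (λ b → ∑ℕ (suc (e ∸ j)) (λ k → U j k b))) ∎
    where
    T : ℕ → ℕ → Mon → Carrier
    T i j a = ∑below a (λ b → H (j ∷ b) ((i ∸ j) ∷ (a ∸ₘ b)) ((e ∸ i) ∷ (m ∸ₘ a)))
    U : ℕ → ℕ → Mon → Carrier
    U j k b = ∑below (m ∸ₘ b) (λ c → H (j ∷ b) (k ∷ c) ((e ∸ j ∸ k) ∷ ((m ∸ₘ b) ∸ₘ c)))
    G : ℕ → ℕ → ℕ → Carrier
    G j k l = ∑below m (λ b → ∑below (m ∸ₘ b) (λ c → H (j ∷ b) (k ∷ c) (l ∷ ((m ∸ₘ b) ∸ₘ c))))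

  zeroMon : Mon → Mon
  zeroMon = map (λ _ → 0)

  ∸ₘ-zeroMon : ∀ m → m ∸ₘ zeroMon m ≡ m
  ∸ₘ-zeroMon []      = ≡.refl
  ∸ₘ-zeroMon (e ∷ m) = ≡.cong (e ∷_) (∸ₘ-zeroMon m)

  ∑below-1ₚ : ∀ m f → ∑below m (λ a → 1ₚ a * f a) ≈ f (zeroMon m)
  ∑below-1ₚ []      f = *-identityˡ (f [])
  ∑below-1ₚ (e ∷ m) f = begin
    ∑below m (λ a → 1ₚ a * f (0 ∷ a)) + ∑ℕ e (λ i → ∑below m (λ a → 0# * f (suc i ∷ a)))
      ≈⟨ +-cong (∑below-1ₚ m (λ a → f (0 ∷ a)))
                (∑ℕ-zero e (λ i _ → trans (∑below-cong m (λ a → zeroˡ (f (suc i ∷ a)))) (∑below-zero m))) ⟩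
    f (0 ∷ zeroMon m) + 0# ≈⟨ +-identityʳ _ ⟩
    f (0 ∷ zeroMon m) ∎

  *ₚ-cong : ∀ {p p′ q q′} → p ≈ₚ p′ → q ≈ₚ q′ → p *ₚ q ≈ₚ p′ *ₚ q′
  *ₚ-cong {p} {p′} {q} {q′} p≈p′ q≈q′ m = begin
    (p *ₚ q) m                         ≈⟨ *ₚ-as-∑below p q m ⟩
    ∑below m (λ a → p a * q (m ∸ₘ a))   ≈⟨ ∑below-cong m (λ a → *-cong (p≈p′ a) (q≈q′ (m ∸ₘ a))) ⟩
    ∑below m (λ a → p′ a * q′ (m ∸ₘ a)) ≈⟨ *ₚ-as-∑below p′ q′ m ⟨
    (p′ *ₚ q′) m                       ∎

  *ₚ-comm : ∀ p q → p *ₚ q ≈ₚ q *ₚ p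
  *ₚ-comm p q m = begin
    (p *ₚ q) m                        ≈⟨ *ₚ-as-∑below p q m ⟩
    ∑below m (λ a → p a * q (m ∸ₘ a))  ≈⟨ ∑below-reflect m (λ a b → p a * q b) ⟩
    ∑below m (λ a → p (m ∸ₘ a) * q a)  ≈⟨ ∑below-cong m (λ a → *-comm _ _) ⟩
    ∑below m (λ a → q a * p (m ∸ₘ a))  ≈⟨ *ₚ-as-∑below q p m ⟨
    (q *ₚ p) m                        ∎

  *ₚ-assoc : ∀ p q r → (p *ₚ q) *ₚ r ≈ₚ p *ₚ (q *ₚ r)
  *ₚ-assoc p q r m = begin
    ((p *ₚ q) *ₚ r) m
      ≈⟨ *ₚ-as-∑below (p *ₚ q) r m ⟩
    ∑below m (λ a → (p *ₚ q) a * r (m ∸ₘ a))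
      ≈⟨ ∑below-cong m (λ a → trans (*-congʳ (*ₚ-as-∑below p q a)) (*-distribʳ-∑below a _ _)) ⟩
    ∑below m (λ a → ∑below a (λ b → p b * q (a ∸ₘ b) * r (m ∸ₘ a)))
      ≈⟨ ∑below-triangle m (λ b c d → p b * q c * r d) ⟩
    ∑below m (λ b → ∑below (m ∸ₘ b) (λ c → p b * q c * r ((m ∸ₘ b) ∸ₘ c)))
      ≈⟨ ∑below-cong m (λ b → trans (∑below-cong (m ∸ₘ b) (λ c → *-assoc _ _ _))
                                    (sym (*-distribˡ-∑below (m ∸ₘ b) (p b) (λ c → q c * r ((m ∸ₘ b) ∸ₘ c))))) ⟩
    ∑below m (λ b → p b * ∑below (m ∸ₘ b) (λ c → q c * r ((m ∸ₘ b) ∸ₘ c)))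
      ≈⟨ ∑below-cong m (λ b → *-congˡ (*ₚ-as-∑below q r (m ∸ₘ b))) ⟨
    ∑below m (λ b → p b * (q *ₚ r) (m ∸ₘ b))
      ≈⟨ *ₚ-as-∑below p (q *ₚ r) m ⟨
    (p *ₚ (q *ₚ r)) m ∎

  *ₚ-identityˡ : ∀ p → 1ₚ *ₚ p ≈ₚ p
  *ₚ-identityˡ p m = begin
    (1ₚ *ₚ p) m                          ≈⟨ *ₚ-as-∑below 1ₚ p m ⟩
    ∑below m (λ a → 1ₚ a * p (m ∸ₘ a))    ≈⟨ ∑below-1ₚ m (λ a → p (m ∸ₘ a)) ⟩
    p (m ∸ₘ zeroMon m)                   ≡⟨ ≡.cong p (∸ₘ-zeroMon m) ⟩
    p m                                  ∎

  *ₚ-distribˡ-+ₚ : ∀ p q r → p *ₚ (q +ₚ r) ≈ₚ p *ₚ q +ₚ p *ₚ r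
  *ₚ-distribˡ-+ₚ p q r m = begin
    (p *ₚ (q +ₚ r)) m
      ≈⟨ *ₚ-as-∑below p (q +ₚ r) m ⟩
    ∑below m (λ a → p a * (q (m ∸ₘ a) + r (m ∸ₘ a)))
      ≈⟨ ∑below-cong m (λ a → distribˡ _ _ _) ⟩
    ∑below m (λ a → p a * q (m ∸ₘ a) + p a * r (m ∸ₘ a))
      ≈⟨ ∑below-distrib-+ m _ _ ⟩
    ∑below m (λ a → p a * q (m ∸ₘ a)) + ∑below m (λ a → p a * r (m ∸ₘ a))
      ≈⟨ +-cong (*ₚ-as-∑below p q m) (*ₚ-as-∑below p r m) ⟨
    (p *ₚ q +ₚ p *ₚ r) m ∎

  polySetoid : Setoid c ℓ₁
  polySetoid = record { isEquivalence = Pointwise.isEquivalence Mon isEquivalence }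

  isCommutativeRingₚ : IsCommutativeRing _≈ₚ_ _+ₚ_ _*ₚ_ -ₚ_ 0ₚ 1ₚ
  isCommutativeRingₚ = record
    { isRing = record
      { +-isAbelianGroup = Pointwise.isAbelianGroup Mon +-isAbelianGroup
      ; *-cong           = *ₚ-cong
      ; *-assoc          = *ₚ-assoc
      ; *-identity       = comm∧idˡ⇒id *ₚ-comm *ₚ-identityˡ
      ; distrib          = comm∧distrˡ⇒distr (λ q≈ r≈ m → +-cong (q≈ m) (r≈ m)) *ₚ-comm *ₚ-distribˡ-+ₚ
      }
    ; *-comm = *ₚ-comm
    }
    where open Consequences polySetoid

  polyRing : CommutativeRing c ℓ₁
  polyRing = record { isCommutativeRing = isCommutativeRingₚ }

module NonNegativity {c ℓ₁ ℓ₂} (R : OrderedCommutativeRing c ℓ₁ ℓ₂) where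
  open OrderedCommutativeRing R
  open PolyDefs R
  open PolynomialRing R using (listSum)
  open import Algebra.Properties.Ring ring using (-1*x≈-x)
  open import Algebra.Properties.Group +-group using (⁻¹-involutive)
  private module ≤ = IsTotalOrder isTotalOrder

  ≤-resp-≈ : ∀ {x y x′ y′} → x ≈ x′ → y ≈ y′ → x ≤ y → x′ ≤ y′
  ≤-resp-≈ x≈x′ y≈y′ x≤y = ≤.≲-respʳ-≈ y≈y′ (≤.≲-respˡ-≈ x≈x′ x≤y)

  0≤-+ : ∀ {x y} → 0# ≤ x → 0# ≤ y → 0# ≤ x + y
  0≤-+ {x} {y} 0≤x 0≤y = ≤.trans (≤-resp-≈ (+-identityʳ 0#) (+-identityʳ x) (+-monoˡ-≤ 0# 0≤x))
                                (≤-resp-≈ (+-identityˡ x) (+-comm y x) (+-monoˡ-≤ x 0≤y))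

  -- either 0 ≤ 1 directly, or 1 ≤ 0 and then 0 ≤ (-1)(-1) = 1
  0≤1 : 0# ≤ 1#
  0≤1 with ≤.total 0# 1#
  ... | inj₁ 0≤1 = 0≤1
  ... | inj₂ 1≤0 = ≤-resp-≈ refl (trans (-1*x≈-x (- 1#)) (⁻¹-involutive 1#)) (0≤-* 0≤-1 0≤-1)
    where
    0≤-1 : 0# ≤ - 1#
    0≤-1 = ≤-resp-≈ (-‿inverseʳ 1#) (+-identityˡ (- 1#)) (+-monoˡ-≤ (- 1#) 1≤0)

  x+x≈0⇒x≈0 : ∀ {x} → x + x ≈ 0# → x ≈ 0#
  x+x≈0⇒x≈0 {x} x+x≈0 with ≤.total 0# x
  ... | inj₁ 0≤x = ≤.antisym (≤-resp-≈ (+-identityˡ x) x+x≈0 (+-monoˡ-≤ x 0≤x)) 0≤x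
  ... | inj₂ x≤0 = ≤.antisym x≤0 (≤-resp-≈ x+x≈0 (+-identityˡ x) (+-monoˡ-≤ x x≤0))

  p+p≈0⇒p≈0 : ∀ {p} → p +ₚ p ≈ₚ 0ₚ → p ≈ₚ 0ₚ
  p+p≈0⇒p≈0 p+p≈0 m = x+x≈0⇒x≈0 (p+p≈0 m)

  NonNeg-resp : ∀ {p q} → p ≈ₚ q → NonNeg p → NonNeg q
  NonNeg-resp p≈q 0≤p m = ≤-resp-≈ refl (p≈q m) (0≤p m)

  NonNeg-0ₚ : NonNeg 0ₚ
  NonNeg-0ₚ m = ≤.refl

  NonNeg-γ : NonNeg γ
  NonNeg-γ m with isVar 0 m
  ... | true  = 0≤1
  ... | false = ≤.refl

  NonNeg-+ₚ : ∀ {p q} → NonNeg p → NonNeg q → NonNeg (p +ₚ q)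
  NonNeg-+ₚ 0≤p 0≤q m = 0≤-+ (0≤p m) (0≤q m)

  listSum-nonneg : ∀ {h} (xs : List Mon) → (∀ a → 0# ≤ h a) → 0# ≤ listSum h xs
  listSum-nonneg []       0≤h = ≤.refl
  listSum-nonneg (x ∷ xs) 0≤h = 0≤-+ (0≤h x) (listSum-nonneg xs 0≤h)

  NonNeg-*ₚ : ∀ {p q} → NonNeg p → NonNeg q → NonNeg (p *ₚ q)
  NonNeg-*ₚ 0≤p 0≤q m = listSum-nonneg (below m) (λ a → 0≤-* (0≤p a) (0≤q (m ∸ₘ a)))

data Adjacent : ∀ {n} → Fin n → Fin n → Set where
  adjacent₀    : ∀ {n} → Adjacent {suc (suc n)} zero (suc zero)
  adjacent-suc : ∀ {n} {x y : Fin n} → Adjacent x y → Adjacent (suc x) (suc y)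

inject₁-adjacent : ∀ {n} (x : Fin n) → Adjacent (inject₁ x) (suc x)
inject₁-adjacent {suc n} zero = adjacent₀
inject₁-adjacent {suc n} (suc x) = adjacent-suc (inject₁-adjacent x)

adjacent-toℕ : ∀ {n} {x y : Fin n} → Adjacent x y → toℕ y ≡ suc (toℕ x)
adjacent-toℕ adjacent₀        = ≡.refl
adjacent-toℕ (adjacent-suc a) = ≡.cong suc (adjacent-toℕ a)

adjacent⇒≢ : ∀ {n} {x y : Fin n} → Adjacent x y → x ≢ y
adjacent⇒≢ a x≡y = ℕ.1+n≢n (≡.sym (≡.trans (≡.cong toℕ x≡y) (adjacent-toℕ a)))

punchOut-adjacent : ∀ {n} {x y : Fin (suc n)} → Adjacent x y →
  ∀ j (j≢x : j ≢ x) (j≢y : j ≢ y) → Adjacent (punchOut j≢x) (punchOut j≢y)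
punchOut-adjacent adjacent₀ zero j≢x j≢y = contradiction ≡.refl j≢x
punchOut-adjacent adjacent₀ (suc zero) j≢x j≢y = contradiction ≡.refl j≢y
punchOut-adjacent {suc (suc n)} adjacent₀ (suc (suc j)) j≢x j≢y = adjacent₀
punchOut-adjacent (adjacent-suc a) zero j≢x j≢y = a
punchOut-adjacent {suc (suc n)} (adjacent-suc a) (suc j) j≢x j≢y =
  adjacent-suc (punchOut-adjacent a j (j≢x ∘ ≡.cong suc) (j≢y ∘ ≡.cong suc))
punchOut-adjacent {suc zero} (adjacent-suc (adjacent-suc {x = ()} _)) (suc j) j≢x j≢y

punchIn-adjacent : ∀ {n} {x y : Fin (suc n)} → Adjacent x y → ∀ k →
  punchIn x k ≡ punchIn y k ⊎ (punchIn x k ≡ y × punchIn y k ≡ x)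
punchIn-adjacent adjacent₀ zero    = inj₂ (≡.refl , ≡.refl)
punchIn-adjacent adjacent₀ (suc k) = inj₁ ≡.refl
punchIn-adjacent (adjacent-suc a) zero = inj₁ ≡.refl
punchIn-adjacent (adjacent-suc a) (suc k) with punchIn-adjacent a k
... | inj₁ eq         = inj₁ (≡.cong suc eq)
... | inj₂ (eq , eq′) = inj₂ (≡.cong suc eq , ≡.cong suc eq′)

-- both sides enumerate, in increasing order, the positions other than j and c
punchIn-punchOut-swap : ∀ {n} (j c : Fin (suc (suc n))) (j≢c : j ≢ c) (c≢j : c ≢ j) (l : Fin n) →
  punchIn j (punchIn (punchOut j≢c) l) ≡ punchIn c (punchIn (punchOut c≢j) l)
punchIn-punchOut-swap zero    zero    j≢c c≢j l = contradiction ≡.refl j≢c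
punchIn-punchOut-swap zero    (suc c) j≢c c≢j l = ≡.refl
punchIn-punchOut-swap (suc j) zero    j≢c c≢j l = ≡.refl
punchIn-punchOut-swap {suc n} (suc j) (suc c) j≢c c≢j zero = ≡.refl
punchIn-punchOut-swap {suc n} (suc j) (suc c) j≢c c≢j (suc l) =
  ≡.cong suc (punchIn-punchOut-swap j c (j≢c ∘ ≡.cong suc) (c≢j ∘ ≡.cong suc) l)

module Determinants {c ℓ₁ ℓ₂} (R : OrderedCommutativeRing c ℓ₁ ℓ₂) where
  open PolyDefs R
  open PolynomialRing R using (polyRing)
  open NonNegativity R using (p+p≈0⇒p≈0)
  open CommutativeRing polyRing hiding (zero)
  open import Algebra.Properties.Semiring.Sum semiring
  open import Algebra.Properties.Ring ring using (-‿distribˡ-*; -‿distribʳ-*)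
  open import Algebra.Properties.Group +-group using (⁻¹-involutive)
  open import Algebra.Solver.Ring.NaturalCoefficients.Default commutativeSemiring
  open import Relation.Binary.Reasoning.Setoid setoid

  Matrix : ℕ → Set c
  Matrix m = Fin m → Fin m → Poly

  minor₀ : ∀ {m} → Matrix (suc m) → Fin (suc m) → Matrix m
  minor₀ M j i k = M (suc i) (punchIn j k)

  laplaceTerm : ∀ {m} → Matrix (suc m) → Fin (suc m) → Poly
  laplaceTerm M j = sign (toℕ j) * M zero j * det (minor₀ M j)

  sumFin≡sum : ∀ {m} (f : Fin m → Poly) → sumFin f ≡ sum f
  sumFin≡sum {zero}  f = ≡.refl
  sumFin≡sum {suc m} f = ≡.cong (f zero +_) (sumFin≡sum (f ∘ suc))

  det-laplace : ∀ {m} (M : Matrix (suc m)) → det M ≡ sum (laplaceTerm M)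
  det-laplace M = sumFin≡sum (laplaceTerm M)

  det-cong : ∀ {m} {M N : Matrix m} → (∀ i j → M i j ≈ N i j) → det M ≈ det N
  det-cong {zero}  M≈N = refl
  det-cong {suc m} {M} {N} M≈N = begin
    det M                ≡⟨ det-laplace M ⟩
    sum (laplaceTerm M)  ≈⟨ sum-cong-≋ (λ j → *-cong (*-congˡ {sign (toℕ j)} (M≈N zero j))
                                          (det-cong (λ i k → M≈N (suc i) (punchIn j k)))) ⟩
    sum (laplaceTerm N)  ≡⟨ det-laplace N ⟨
    det N                ∎

  -x*-y≈x*y : ∀ a b → (- a) * (- b) ≈ a * b
  -x*-y≈x*y a b = begin
    - a * - b     ≈⟨ -‿distribˡ-* a (- b) ⟨
    - (a * - b)   ≈⟨ -‿cong (-‿distribʳ-* a b) ⟨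
    - - (a * b)   ≈⟨ ⁻¹-involutive (a * b) ⟩
    a * b         ∎

  sign-punchOut-swap : ∀ {n} (j c : Fin (suc (suc n))) (j≢c : j ≢ c) (c≢j : c ≢ j) →
    sign (toℕ j) * sign (toℕ (punchOut j≢c)) ≈ - (sign (toℕ c) * sign (toℕ (punchOut c≢j)))
  sign-punchOut-swap zero zero j≢c c≢j = contradiction ≡.refl j≢c
  sign-punchOut-swap zero (suc c) j≢c c≢j = trans (*-identityˡ (sign (toℕ c)))
    (sym (trans (-‿cong (*-identityʳ (- sign (toℕ c)))) (⁻¹-involutive (sign (toℕ c)))))
  sign-punchOut-swap (suc j) zero j≢c c≢j =
    trans (*-identityʳ (- sign (toℕ j))) (-‿cong (sym (*-identityˡ (sign (toℕ j)))))
  sign-punchOut-swap {zero} (suc zero) (suc zero) j≢c c≢j = contradiction ≡.refl j≢c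
  sign-punchOut-swap {suc n} (suc j) (suc c) j≢c c≢j = begin
    - sign (toℕ j) * - sign (toℕ (punchOut (j≢c ∘ ≡.cong suc)))
      ≈⟨ -x*-y≈x*y (sign (toℕ j)) (sign (toℕ (punchOut (j≢c ∘ ≡.cong suc)))) ⟩
    sign (toℕ j) * sign (toℕ (punchOut (j≢c ∘ ≡.cong suc)))
      ≈⟨ sign-punchOut-swap j c (j≢c ∘ ≡.cong suc) (c≢j ∘ ≡.cong suc) ⟩
    - (sign (toℕ c) * sign (toℕ (punchOut (c≢j ∘ ≡.cong suc))))
      ≈⟨ -‿cong (-x*-y≈x*y (sign (toℕ c)) (sign (toℕ (punchOut (c≢j ∘ ≡.cong suc))))) ⟨
    - (- sign (toℕ c) * - sign (toℕ (punchOut (c≢j ∘ ≡.cong suc)))) ∎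

  sum-zero : ∀ {m} {f : Fin m → Poly} → (∀ j → f j ≈ 0#) → sum f ≈ 0#
  sum-zero {m} f≈0 = trans (sum-cong-≋ f≈0) (sum-replicate-zero m)

  det-via-terms : ∀ {m} (M U V : Matrix (suc m)) (a : Poly) →
    (∀ j → laplaceTerm M j ≈ laplaceTerm U j + a * laplaceTerm V j) → det M ≈ det U + a * det V
  det-via-terms M U V a termwise = begin
    det M                                             ≡⟨ det-laplace M ⟩
    sum (laplaceTerm M)                               ≈⟨ sum-cong-≋ termwise ⟩
    sum (λ j → laplaceTerm U j + a * laplaceTerm V j) ≈⟨ ∑-distrib-+ (laplaceTerm U) (λ j → a * laplaceTerm V j) ⟩
    sum (laplaceTerm U) + sum (λ j → a * laplaceTerm V j)
      ≈⟨ +-congˡ (*-distribˡ-sum a (laplaceTerm V)) ⟨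
    sum (laplaceTerm U) + a * sum (laplaceTerm V)     ≡⟨ ≡.cong₂ (λ d e → d + a * e) (det-laplace U) (det-laplace V) ⟨
    det U + a * det V                                 ∎

  private
    linear-entry : ∀ s u v a d → s * (u + a * v) * d ≈ s * u * d + a * (s * v * d)
    linear-entry = solve 5 (λ s u v a d → s :* (u :+ a :* v) :* d := s :* u :* d :+ a :* (s :* v :* d)) refl

    linear-minor : ∀ s u a d e → s * u * (d + a * e) ≈ s * u * d + a * (s * u * e)
    linear-minor = solve 5 (λ s u a d e → s :* u :* (d :+ a :* e) := s :* u :* d :+ a :* (s :* u :* e)) refl

  det-linear-row : ∀ {m} (M U V : Matrix m) (a : Poly) (r : Fin m) →
    (∀ i j → i ≢ r → M i j ≈ U i j) → (∀ i j → i ≢ r → V i j ≈ U i j) →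
    (∀ j → M r j ≈ U r j + a * V r j) → det M ≈ det U + a * det V
  det-linear-row {suc m} M U V a zero M≈U V≈U Mᵣ≈ = det-via-terms M U V a λ j → begin
    sign (toℕ j) * M zero j * det (minor₀ M j)
      ≈⟨ *-cong (*-congˡ {sign (toℕ j)} (Mᵣ≈ j)) (minor≈ M≈U j) ⟩
    sign (toℕ j) * (U zero j + a * V zero j) * det (minor₀ U j)
      ≈⟨ linear-entry (sign (toℕ j)) (U zero j) (V zero j) a (det (minor₀ U j)) ⟩
    sign (toℕ j) * U zero j * det (minor₀ U j) + a * (sign (toℕ j) * V zero j * det (minor₀ U j))
      ≈⟨ +-congˡ (*-congˡ {a} (*-congˡ {sign (toℕ j) * V zero j} (minor≈ V≈U j))) ⟨
    laplaceTerm U j + a * laplaceTerm V j ∎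
    where
    minor≈ : ∀ {N} → (∀ i j → i ≢ zero → N i j ≈ U i j) → ∀ j → det (minor₀ N j) ≈ det (minor₀ U j)
    minor≈ N≈U j = det-cong (λ i k → N≈U (suc i) (punchIn j k) λ ())
  det-linear-row {suc m} M U V a (suc r) M≈U V≈U Mᵣ≈ = det-via-terms M U V a λ j → begin
    sign (toℕ j) * M zero j * det (minor₀ M j)
      ≈⟨ *-cong (*-congˡ {sign (toℕ j)} (M≈U zero j λ ())) (minor-linear j) ⟩
    sign (toℕ j) * U zero j * (det (minor₀ U j) + a * det (minor₀ V j))
      ≈⟨ linear-minor (sign (toℕ j)) (U zero j) a (det (minor₀ U j)) (det (minor₀ V j)) ⟩
    laplaceTerm U j + a * (sign (toℕ j) * U zero j * det (minor₀ V j))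
      ≈⟨ +-congˡ (*-congˡ {a} (*-congʳ {det (minor₀ V j)} (*-congˡ {sign (toℕ j)} (V≈U zero j λ ())))) ⟨
    laplaceTerm U j + a * laplaceTerm V j ∎
    where
    minor-linear : ∀ j → det (minor₀ M j) ≈ det (minor₀ U j) + a * det (minor₀ V j)
    minor-linear j = det-linear-row (minor₀ M j) (minor₀ U j) (minor₀ V j) a r
      (λ i k i≢r → M≈U (suc i) (punchIn j k) (i≢r ∘ Fin.suc-injective))
      (λ i k i≢r → V≈U (suc i) (punchIn j k) (i≢r ∘ Fin.suc-injective))
      (λ k → Mᵣ≈ (punchIn j k))

  det-linear-col : ∀ {m} (M U V : Matrix m) (a : Poly) (r : Fin m) →
    (∀ i j → j ≢ r → M i j ≈ U i j) → (∀ i j → j ≢ r → V i j ≈ U i j) →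
    (∀ i → M i r ≈ U i r + a * V i r) → det M ≈ det U + a * det V
  det-linear-col {suc m} M U V a r M≈U V≈U Mᵣ≈ = det-via-terms M U V a term
    where
    term : ∀ j → laplaceTerm M j ≈ laplaceTerm U j + a * laplaceTerm V j
    term j with j Fin.≟ r
    ... | yes ≡.refl = begin
      sign (toℕ j) * M zero j * det (minor₀ M j)
        ≈⟨ *-cong (*-congˡ {sign (toℕ j)} (Mᵣ≈ zero)) (minor≈ M≈U) ⟩
      sign (toℕ j) * (U zero j + a * V zero j) * det (minor₀ U j)
        ≈⟨ linear-entry (sign (toℕ j)) (U zero j) (V zero j) a (det (minor₀ U j)) ⟩
      sign (toℕ j) * U zero j * det (minor₀ U j) + a * (sign (toℕ j) * V zero j * det (minor₀ U j))
        ≈⟨ +-congˡ (*-congˡ {a} (*-congˡ {sign (toℕ j) * V zero j} (minor≈ V≈U))) ⟨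
      laplaceTerm U j + a * laplaceTerm V j ∎
      where
      minor≈ : ∀ {N} → (∀ i k → k ≢ j → N i k ≈ U i k) → det (minor₀ N j) ≈ det (minor₀ U j)
      minor≈ N≈U = det-cong (λ i k → N≈U (suc i) (punchIn j k) (Fin.punchInᵢ≢i j k))
    ... | no j≢r = begin
      sign (toℕ j) * M zero j * det (minor₀ M j)
        ≈⟨ *-cong (*-congˡ {sign (toℕ j)} (M≈U zero j j≢r)) minor-linear ⟩
      sign (toℕ j) * U zero j * (det (minor₀ U j) + a * det (minor₀ V j))
        ≈⟨ linear-minor (sign (toℕ j)) (U zero j) a (det (minor₀ U j)) (det (minor₀ V j)) ⟩
      laplaceTerm U j + a * (sign (toℕ j) * U zero j * det (minor₀ V j))
        ≈⟨ +-congˡ (*-congˡ {a} (*-congʳ {det (minor₀ V j)} (*-congˡ {sign (toℕ j)} (V≈U zero j j≢r)))) ⟨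
      laplaceTerm U j + a * laplaceTerm V j ∎
      where
      avoids-r : ∀ k → k ≢ punchOut j≢r → punchIn j k ≢ r
      avoids-r k k≢ jk≡r = k≢ (≡.sym (≡.trans (Fin.punchOut-cong j (≡.sym jk≡r)) (Fin.punchOut-punchIn j)))
      minor-linear : det (minor₀ M j) ≈ det (minor₀ U j) + a * det (minor₀ V j)
      minor-linear = det-linear-col (minor₀ M j) (minor₀ U j) (minor₀ V j) a (punchOut j≢r)
        (λ i k k≢ → M≈U (suc i) (punchIn j k) (avoids-r k k≢))
        (λ i k k≢ → V≈U (suc i) (punchIn j k) (avoids-r k k≢))
        (λ i → ≡.subst (λ z → M (suc i) z ≈ U (suc i) z + a * V (suc i) z)
                       (≡.sym (Fin.punchIn-punchOut j≢r)) (Mᵣ≈ (suc i)))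

  -- Expanding along the two equal rows gives det M = X, a double sum whose terms are antisymmetric
  -- in the two deleted columns; so X + X = 0, which forces X = 0 in an ordered ring.
  det-equal-first-rows : ∀ {n} (M : Matrix (suc (suc n))) →
    (∀ j → M zero j ≈ M (suc zero) j) → det M ≈ 0#
  det-equal-first-rows {n} M M₀≈M₁ = trans det≈X (p+p≈0⇒p≈0 X+X≈0)
    where
    u : Fin (suc (suc n)) → Poly
    u = M zero
    Δ : (Fin n → Fin (suc (suc n))) → Poly
    Δ f = det (λ i l → M (suc (suc i)) (f l))
    T : Fin (suc (suc n)) → Fin (suc n) → Poly
    T j k = sign (toℕ j) * u j * (sign (toℕ k) * u (punchIn j k) * Δ (punchIn j ∘ punchIn k))
    G : Fin (suc (suc n)) → Fin (suc (suc n)) → Poly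
    G j c with j Fin.≟ c
    ... | yes _   = 0#
    ... | no j≢c = sign (toℕ j) * u j * (sign (toℕ (punchOut j≢c)) * u c * Δ (punchIn j ∘ punchIn (punchOut j≢c)))
    X : Poly
    X = sum (λ j → sum (G j))

    Δ-cong : ∀ {f g} → (∀ l → f l ≡ g l) → Δ f ≈ Δ g
    Δ-cong f≗g = det-cong (λ i l → reflexive (≡.cong (M (suc (suc i))) (f≗g l)))

    G-diagonal : ∀ j → G j j ≈ 0#
    G-diagonal j with j Fin.≟ j
    ... | yes _   = refl
    ... | no j≢j = contradiction ≡.refl j≢j

    G-punchIn : ∀ j k → G j (punchIn j k) ≈ T j k
    G-punchIn j k with j Fin.≟ punchIn j k
    ... | yes j≡jk = contradiction (≡.sym j≡jk) (Fin.punchInᵢ≢i j k)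
    ... | no j≢jk = reflexive (≡.cong (λ z → sign (toℕ j) * u j * (sign (toℕ z) * u (punchIn j k) * Δ (punchIn j ∘ punchIn z)))
                        (≡.trans (Fin.punchOut-cong j ≡.refl) (Fin.punchOut-punchIn j)))

    G-antisymmetric : ∀ j c → G j c ≈ - G c j
    G-antisymmetric j c with j Fin.≟ c | c Fin.≟ j
    ... | yes _   | yes _   = sym (ε⁻¹≈ε)
      where open import Algebra.Properties.Group +-group using (ε⁻¹≈ε)
    ... | yes j≡c | no c≢j = contradiction (≡.sym j≡c) c≢j
    ... | no j≢c | yes c≡j = contradiction (≡.sym c≡j) j≢c
    ... | no j≢c | no c≢j = begin
      σj * u j * (σj′ * u c * Δj)      ≈⟨ regroup σj (u j) σj′ (u c) Δj ⟩
      σj * σj′ * (u j * (u c * Δj))    ≈⟨ *-cong (sign-punchOut-swap j c j≢c c≢j)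
                                            (*-congˡ {u j} (*-congˡ {u c} (Δ-cong (punchIn-punchOut-swap j c j≢c c≢j)))) ⟩
      - (σc * σc′) * (u j * (u c * Δc)) ≈⟨ -‿distribˡ-* (σc * σc′) (u j * (u c * Δc)) ⟨
      - (σc * σc′ * (u j * (u c * Δc))) ≈⟨ -‿cong (regroup′ σc (u c) σc′ (u j) Δc) ⟨
      - (σc * u c * (σc′ * u j * Δc))   ∎
      where
      σj σj′ σc σc′ Δj Δc : Poly
      σj  = sign (toℕ j)
      σj′ = sign (toℕ (punchOut j≢c))
      σc  = sign (toℕ c)
      σc′ = sign (toℕ (punchOut c≢j))
      Δj  = Δ (punchIn j ∘ punchIn (punchOut j≢c))
      Δc  = Δ (punchIn c ∘ punchIn (punchOut c≢j))
      regroup : ∀ a x b y d → a * x * (b * y * d) ≈ a * b * (x * (y * d))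
      regroup = solve 5 (λ a x b y d → a :* x :* (b :* y :* d) := a :* b :* (x :* (y :* d))) refl
      regroup′ : ∀ a x b y d → a * x * (b * y * d) ≈ a * b * (y * (x * d))
      regroup′ = solve 5 (λ a x b y d → a :* x :* (b :* y :* d) := a :* b :* (y :* (x :* d))) refl

    laplace-twice : ∀ j → laplaceTerm M j ≈ sum (T j)
    laplace-twice j = begin
      sign (toℕ j) * u j * det (minor₀ M j)
        ≡⟨ ≡.cong (sign (toℕ j) * u j *_) (det-laplace (minor₀ M j)) ⟩
      sign (toℕ j) * u j * sum (laplaceTerm (minor₀ M j))
        ≈⟨ *-distribˡ-sum (sign (toℕ j) * u j) (laplaceTerm (minor₀ M j)) ⟩
      sum (λ k → sign (toℕ j) * u j * laplaceTerm (minor₀ M j) k)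
        ≈⟨ sum-cong-≋ (λ k → *-congˡ {sign (toℕ j) * u j} (*-congʳ {Δ (punchIn j ∘ punchIn k)}
             (*-congˡ {sign (toℕ k)} (M₀≈M₁ (punchIn j k))))) ⟨
      sum (T j) ∎

    remove-diagonal : ∀ j → sum (T j) ≈ sum (G j)
    remove-diagonal j = begin
      sum (T j)                        ≈⟨ sum-cong-≋ (G-punchIn j) ⟨
      sum (G j ∘ punchIn j)            ≈⟨ +-identityˡ _ ⟨
      0# + sum (G j ∘ punchIn j)       ≈⟨ +-congʳ (G-diagonal j) ⟨
      G j j + sum (G j ∘ punchIn j)    ≈⟨ sum-remove {i = j} (G j) ⟨
      sum (G j)                        ∎

    det≈X : det M ≈ X
    det≈X = begin
      det M                            ≡⟨ det-laplace M ⟩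
      sum (laplaceTerm M)              ≈⟨ sum-cong-≋ (λ j → trans (laplace-twice j) (remove-diagonal j)) ⟩
      X                                ∎

    X+X≈0 : X + X ≈ 0#
    X+X≈0 = begin
      X + X                                                 ≈⟨ +-congˡ (∑-comm G) ⟩
      X + sum (λ j → sum (λ c → G c j))                     ≈⟨ ∑-distrib-+ (λ j → sum (G j)) (λ j → sum (λ c → G c j)) ⟨
      sum (λ j → sum (G j) + sum (λ c → G c j))             ≈⟨ sum-cong-≋ (λ j → ∑-distrib-+ (G j) (λ c → G c j)) ⟨
      sum (λ j → sum (λ c → G j c + G c j))                 ≈⟨ sum-zero (λ j → sum-zero (λ c → cancel j c)) ⟩
      0#                                                    ∎
      where
      cancel : ∀ j c → G j c + G c j ≈ 0#
      cancel j c = trans (+-congʳ (G-antisymmetric j c)) (-‿inverseˡ (G c j))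

  det-adjacent-rows : ∀ {m} (M : Matrix m) {x y} → Adjacent x y → (∀ j → M x j ≈ M y j) → det M ≈ 0#
  det-adjacent-rows M adjacent₀ Mx≈My = det-equal-first-rows M Mx≈My
  det-adjacent-rows {suc m} M (adjacent-suc a) Mx≈My = begin
    det M                ≡⟨ det-laplace M ⟩
    sum (laplaceTerm M)  ≈⟨ sum-zero (λ j → trans (*-congˡ {sign (toℕ j) * M zero j}
                              (det-adjacent-rows (minor₀ M j) a (λ k → Mx≈My (punchIn j k))))
                              (zeroʳ (sign (toℕ j) * M zero j))) ⟩
    0#                   ∎

  -- the terms for the two equal columns cancel, all others vanish by induction
  det-adjacent-cols : ∀ {m} (M : Matrix m) {x y} → Adjacent x y → (∀ i → M i x ≈ M i y) → det M ≈ 0#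
  det-adjacent-cols {suc zero} M (adjacent-suc {x = ()} _) _
  det-adjacent-cols {suc (suc m)} M {x} {y} a Mx≈My = begin
    det M                                               ≡⟨ det-laplace M ⟩
    sum T                                               ≈⟨ sum-remove {i = x} T ⟩
    T x + sum (T ∘ punchIn x)                           ≈⟨ +-congˡ (sum-remove {i = k₀} (T ∘ punchIn x)) ⟩
    T x + (T (punchIn x k₀) + sum (T ∘ punchIn x ∘ punchIn k₀))
      ≈⟨ +-congˡ (+-cong (reflexive (≡.cong T (Fin.punchIn-punchOut x≢y)))
                         (sum-zero (others-vanish det-adjacent-cols))) ⟩
    T x + (T y + 0#)                                    ≈⟨ +-congˡ (trans (+-identityʳ (T y)) Ty≈-Tx) ⟩
    T x + - T x                                         ≈⟨ -‿inverseʳ (T x) ⟩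
    0#                                                  ∎
    where
    T = laplaceTerm M
    x≢y : x ≢ y
    x≢y = adjacent⇒≢ a
    k₀ = punchOut x≢y

    minor-swap : ∀ i k → minor₀ M y i k ≈ minor₀ M x i k
    minor-swap i k with punchIn-adjacent a k
    ... | inj₁ eq         = reflexive (≡.cong (M (suc i)) (≡.sym eq))
    ... | inj₂ (eq , eq′) = trans (reflexive (≡.cong (M (suc i)) eq′))
                              (trans (Mx≈My (suc i)) (reflexive (≡.cong (M (suc i)) (≡.sym eq))))

    Ty≈-Tx : T y ≈ - T x
    Ty≈-Tx = begin
      sign (toℕ y) * M zero y * det (minor₀ M y)
        ≈⟨ *-cong (*-cong (reflexive (≡.cong sign (adjacent-toℕ a))) (sym (Mx≈My zero))) (det-cong minor-swap) ⟩
      - sign (toℕ x) * M zero x * det (minor₀ M x)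
        ≈⟨ *-congʳ {det (minor₀ M x)} (-‿distribˡ-* (sign (toℕ x)) (M zero x)) ⟨
      - (sign (toℕ x) * M zero x) * det (minor₀ M x)
        ≈⟨ -‿distribˡ-* (sign (toℕ x) * M zero x) (det (minor₀ M x)) ⟨
      - T x ∎

    others-vanish : (∀ (N : Matrix (suc m)) {x′ y′} → Adjacent x′ y′ → (∀ i → N i x′ ≈ N i y′) → det N ≈ 0#) →
                    ∀ l → T (punchIn x (punchIn k₀ l)) ≈ 0#
    others-vanish smaller-vanishes l = trans (*-congˡ {sign (toℕ j) * M zero j}
                              (smaller-vanishes (minor₀ M j) (punchOut-adjacent a j j≢x j≢y) equal-cols))
                            (zeroʳ (sign (toℕ j) * M zero j))
      where
      j = punchIn x (punchIn k₀ l)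
      j≢x : j ≢ x
      j≢x = Fin.punchInᵢ≢i x (punchIn k₀ l)
      j≢y : j ≢ y
      j≢y j≡y = Fin.punchInᵢ≢i k₀ l (Fin.punchIn-injective x (punchIn k₀ l) k₀
                  (≡.trans j≡y (≡.sym (Fin.punchIn-punchOut x≢y))))
      equal-cols : ∀ i → minor₀ M j i (punchOut j≢x) ≈ minor₀ M j i (punchOut j≢y)
      equal-cols i = trans (reflexive (≡.cong (M (suc i)) (Fin.punchIn-punchOut j≢x)))
                       (trans (Mx≈My (suc i)) (reflexive (≡.cong (M (suc i)) (≡.sym (Fin.punchIn-punchOut j≢y)))))

module Bidiagonal {c ℓ₁ ℓ₂} (R : OrderedCommutativeRing c ℓ₁ ℓ₂) where
  open PolyDefs R

  -- multiplication by the unit lower bidiagonal matrix with subdiagonal a₁, a₂, …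
  bidiagonal : (ℕ → Poly) → (ℕ → Poly) → ℕ → Poly
  bidiagonal a s zero    = s zero
  bidiagonal a s (suc n) = s (suc n) +ₚ a (suc n) *ₚ s n

  bidiagonalRows : (ℕ → Poly) → Array → Array
  bidiagonalRows a X n k = bidiagonal a (λ t → X t k) n

  bidiagonalCols : (ℕ → Poly) → Array → Array
  bidiagonalCols a X n k = bidiagonal a (X n) k

module TotalPositivity {c ℓ₁ ℓ₂} (R : OrderedCommutativeRing c ℓ₁ ℓ₂) where
  open import Data.Nat using (_<_; _≤_)
  open PolyDefs R
  open PolynomialRing R using (polyRing)
  open CommutativeRing polyRing hiding (zero)
  open NonNegativity R using (NonNeg-resp; NonNeg-0ₚ; NonNeg-+ₚ; NonNeg-*ₚ)
  open Determinants R
  open Bidiagonal R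

  StrictlyIncreasing⇒monotone : ∀ {m} {rows : Fin m → ℕ} → StrictlyIncreasing rows →
    ∀ {i j} → i Fin.≤ j → rows i ≤ rows j
  StrictlyIncreasing⇒monotone {rows = rows} rows↑ {i} {j} i≤j with i Fin.≟ j
  ... | yes ≡.refl = ℕ.≤-refl
  ... | no i≢j    = ℕ.<⇒≤ (rows↑ i j (Fin.≤∧≢⇒< i≤j i≢j))

  StrictlyIncreasing-decrement : ∀ {m} {rows : Fin m → ℕ} → StrictlyIncreasing rows → ∀ r →
    (∀ i → i Fin.< r → rows i < ℕ.pred (rows r)) → StrictlyIncreasing (updateAt rows r ℕ.pred)
  StrictlyIncreasing-decrement {rows = rows} rows↑ r earlier i j i<j with i Fin.≟ r | j Fin.≟ r
  ... | yes ≡.refl | yes ≡.refl = contradiction i<j (ℕ.<-irrefl ≡.refl)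
  ... | yes ≡.refl | no j≢r = begin-strict
    updateAt rows r ℕ.pred r ≡⟨ updateAt-updates r rows ⟩
    ℕ.pred (rows r)          ≤⟨ ℕ.pred[n]≤n ⟩
    rows r                   <⟨ rows↑ r j i<j ⟩
    rows j                   ≡⟨ updateAt-minimal j r rows j≢r ⟨
    updateAt rows r ℕ.pred j ∎
    where open ℕ.≤-Reasoning
  ... | no i≢r | yes ≡.refl = begin-strict
    updateAt rows r ℕ.pred i ≡⟨ updateAt-minimal i r rows i≢r ⟩
    rows i                   <⟨ earlier i i<j ⟩
    ℕ.pred (rows r)          ≡⟨ updateAt-updates r rows ⟨
    updateAt rows r ℕ.pred r ∎
    where open ℕ.≤-Reasoning
  ... | no i≢r | no j≢r = ≡.subst₂ _<_ (≡.sym (updateAt-minimal i r rows i≢r))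
                                       (≡.sym (updateAt-minimal j r rows j≢r)) (rows↑ i j i<j)

  -- The rows of a minor are transformed one at a time, from the last to the first. By linearity in
  -- the changed row n, the minor becomes the previous one plus aₙ times the minor with row n replaced
  -- by row n - 1; that minor is again of the previous kind, or has two equal adjacent rows.
  module BidiagonalRowMinors
    (Φ : ∀ {m} → Matrix m → Poly)
    (Φ-cong : ∀ {m} {M N : Matrix m} → (∀ i j → M i j ≈ N i j) → Φ M ≈ Φ N)
    (Φ-linear : ∀ {m} (M U V : Matrix m) (a : Poly) (r : Fin m) →
       (∀ i j → i ≢ r → M i j ≈ U i j) → (∀ i j → i ≢ r → V i j ≈ U i j) →
       (∀ j → M r j ≈ U r j + a * V r j) → Φ M ≈ Φ U + a * Φ V)
    (Φ-adjacent : ∀ {m} (M : Matrix m) {x y} → Adjacent x y → (∀ j → M x j ≈ M y j) → Φ M ≈ 0#)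
    (Y : Array) (a : ℕ → Poly) (a≥0 : ∀ n → NonNeg (a n)) {m} (cols : Fin m → ℕ)
    (Y≥0 : ∀ rows → StrictlyIncreasing rows → NonNeg (Φ (λ i j → Y (rows i) (cols j))))
    where

    mixed : ℕ → (Fin m → ℕ) → Matrix m
    mixed t rows i j with toℕ i <? t
    ... | yes _ = Y (rows i) (cols j)
    ... | no  _ = bidiagonalRows a Y (rows i) (cols j)

    mixed-< : ∀ {t} rows i j → toℕ i < t → mixed t rows i j ≡ Y (rows i) (cols j)
    mixed-< {t} rows i j i<t with toℕ i <? t
    ... | yes _  = ≡.refl
    ... | no i≮t = contradiction i<t i≮t

    mixed-≮ : ∀ {t} rows i j → ¬ toℕ i < t → mixed t rows i j ≡ bidiagonalRows a Y (rows i) (cols j)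
    mixed-≮ {t} rows i j i≮t with toℕ i <? t
    ... | yes i<t = contradiction i<t i≮t
    ... | no _    = ≡.refl

    mixed-suc : ∀ {t} rows i j → toℕ i ≢ t → mixed t rows i j ≡ mixed (suc t) rows i j
    mixed-suc {t} rows i j i≢t with toℕ i <? t
    ... | yes i<t = ≡.sym (mixed-< rows i j (ℕ.m<n⇒m<1+n i<t))
    ... | no i≮t  = ≡.sym (mixed-≮ rows i j (λ i<1+t → i≮t (ℕ.≤∧≢⇒< (ℕ.s≤s⁻¹ i<1+t) i≢t)))

    mixed-rows : ∀ {t} rows rows′ i j → rows i ≡ rows′ i → mixed t rows i j ≡ mixed t rows′ i j
    mixed-rows {t} rows rows′ i j eq with toℕ i <? t
    ... | yes _ = ≡.cong (λ n → Y n (cols j)) eq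
    ... | no  _ = ≡.cong (λ n → bidiagonalRows a Y n (cols j)) eq

    MixedNonNeg : ℕ → Set ℓ₂
    MixedNonNeg t = ∀ rows → StrictlyIncreasing rows → NonNeg (Φ (mixed t rows))

    mixed-untransformed : MixedNonNeg m
    mixed-untransformed rows rows↑ =
      NonNeg-resp (Φ-cong (λ i j → reflexive (≡.sym (mixed-< rows i j (Fin.toℕ<n i))))) (Y≥0 rows rows↑)

    decremented-nonneg : ∀ r {rows} q → StrictlyIncreasing rows → rows r ≡ suc q → MixedNonNeg (suc (toℕ r)) →
      NonNeg (Φ (mixed (suc (toℕ r)) (updateAt rows r ℕ.pred)))
    decremented-nonneg zero    q rows↑ eq IH = IH _ (StrictlyIncreasing-decrement rows↑ zero (λ i ()))
    decremented-nonneg (suc s) {rows} q rows↑ eq IH with rows (inject₁ s) ℕ.≟ q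
    ... | yes eq′ = NonNeg-resp (sym (Φ-adjacent _ (inject₁-adjacent s) equal-rows)) NonNeg-0ₚ
      where
      rows′ = updateAt rows (suc s) ℕ.pred
      rows′-below : rows′ (inject₁ s) ≡ q
      rows′-below = ≡.trans (updateAt-minimal (inject₁ s) (suc s) rows (adjacent⇒≢ (inject₁-adjacent s))) eq′
      rows′-at : rows′ (suc s) ≡ q
      rows′-at = ≡.trans (updateAt-updates (suc s) rows) (≡.cong ℕ.pred eq)
      equal-rows : ∀ j → mixed (suc (suc (toℕ s))) rows′ (inject₁ s) j ≈ mixed (suc (suc (toℕ s))) rows′ (suc s) j
      equal-rows j = reflexive (begin
        mixed (suc (suc (toℕ s))) rows′ (inject₁ s) j
          ≡⟨ mixed-< rows′ (inject₁ s) j (ℕ.m<n⇒m<1+n (s<s (ℕ.≤-reflexive (Fin.toℕ-inject₁ s)))) ⟩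
        Y (rows′ (inject₁ s)) (cols j)  ≡⟨ ≡.cong (λ n → Y n (cols j)) (≡.trans rows′-below (≡.sym rows′-at)) ⟩
        Y (rows′ (suc s)) (cols j)      ≡⟨ mixed-< rows′ (suc s) j (ℕ.n<1+n _) ⟨
        mixed (suc (suc (toℕ s))) rows′ (suc s) j ∎)
        where open ≡.≡-Reasoning
    ... | no ≢q = IH _ (StrictlyIncreasing-decrement rows↑ (suc s) earlier-below)
      where
      below-q : rows (inject₁ s) < q
      below-q = ℕ.≤∧≢⇒< (ℕ.s≤s⁻¹ (≡.subst (rows (inject₁ s) <_) eq
                  (rows↑ (inject₁ s) (suc s) (s<s (ℕ.≤-reflexive (Fin.toℕ-inject₁ s)))))) ≢q
      earlier-below : ∀ i → i Fin.< suc s → rows i < ℕ.pred (rows (suc s))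
      earlier-below i i<s = ≡.subst (rows i <_) (≡.cong ℕ.pred (≡.sym eq))
        (ℕ.≤-<-trans (StrictlyIncreasing⇒monotone rows↑ (ℕ.≤-trans (ℕ.s≤s⁻¹ i<s) (ℕ.≤-reflexive (≡.sym (Fin.toℕ-inject₁ s)))))
                     below-q)

    mixed-step : ∀ r → MixedNonNeg (suc (toℕ r)) → MixedNonNeg (toℕ r)
    mixed-step r IH rows rows↑ with rows r in eq
    ... | zero  = NonNeg-resp (Φ-cong unchanged) (IH rows rows↑)
      where
      unchanged : ∀ i j → mixed (suc (toℕ r)) rows i j ≈ mixed (toℕ r) rows i j
      unchanged i j with i Fin.≟ r
      ... | no i≢r    = reflexive (≡.sym (mixed-suc rows i j (i≢r ∘ Fin.toℕ-injective)))
      ... | yes ≡.refl = reflexive (begin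
        mixed (suc (toℕ i)) rows i j        ≡⟨ mixed-< rows i j (ℕ.n<1+n _) ⟩
        Y (rows i) (cols j)                 ≡⟨ ≡.cong (λ n → Y n (cols j)) eq ⟩
        Y 0 (cols j)                        ≡⟨ ≡.cong (λ n → bidiagonalRows a Y n (cols j)) eq ⟨
        bidiagonalRows a Y (rows i) (cols j) ≡⟨ mixed-≮ rows i j (ℕ.<-irrefl ≡.refl) ⟨
        mixed (toℕ i) rows i j ∎)
        where open ≡.≡-Reasoning
    ... | suc q = NonNeg-resp (sym split)
                    (NonNeg-+ₚ (IH rows rows↑) (NonNeg-*ₚ (a≥0 (suc q)) (decremented-nonneg r q rows↑ eq IH)))
      where
      rows′ = updateAt rows r ℕ.pred
      row-r : ∀ j → mixed (toℕ r) rows r j ≈ mixed (suc (toℕ r)) rows r j + a (suc q) * mixed (suc (toℕ r)) rows′ r j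
      row-r j = reflexive (begin
        mixed (toℕ r) rows r j                  ≡⟨ mixed-≮ rows r j (ℕ.<-irrefl ≡.refl) ⟩
        bidiagonalRows a Y (rows r) (cols j)    ≡⟨ ≡.cong (λ n → bidiagonalRows a Y n (cols j)) eq ⟩
        Y (suc q) (cols j) + a (suc q) * Y q (cols j)
          ≡⟨ ≡.cong₂ (λ n n′ → Y n (cols j) + a (suc q) * Y n′ (cols j)) (≡.sym eq)
                     (≡.trans (≡.cong ℕ.pred (≡.sym eq)) (≡.sym (updateAt-updates r rows))) ⟩
        Y (rows r) (cols j) + a (suc q) * Y (rows′ r) (cols j)
          ≡⟨ ≡.cong₂ (λ u v → u + a (suc q) * v) (mixed-< rows r j (ℕ.n<1+n _)) (mixed-< rows′ r j (ℕ.n<1+n _)) ⟨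
        mixed (suc (toℕ r)) rows r j + a (suc q) * mixed (suc (toℕ r)) rows′ r j ∎)
        where open ≡.≡-Reasoning
      split : Φ (mixed (toℕ r) rows) ≈ Φ (mixed (suc (toℕ r)) rows) + a (suc q) * Φ (mixed (suc (toℕ r)) rows′)
      split = Φ-linear (mixed (toℕ r) rows) (mixed (suc (toℕ r)) rows) (mixed (suc (toℕ r)) rows′) (a (suc q)) r
        (λ i j i≢r → reflexive (mixed-suc rows i j (i≢r ∘ Fin.toℕ-injective)))
        (λ i j i≢r → reflexive (mixed-rows {suc (toℕ r)} rows′ rows i j (updateAt-minimal i r rows i≢r)))
        row-r

    mixed-nonneg : ∀ d t → d ℕ.+ t ≡ m → MixedNonNeg t
    mixed-nonneg zero    t eq = ≡.subst MixedNonNeg (≡.sym eq) mixed-untransformed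
    mixed-nonneg (suc d) t eq = ≡.subst MixedNonNeg (Fin.toℕ-fromℕ< t<m)
      (mixed-step (Fin.fromℕ< t<m) (≡.subst (MixedNonNeg ∘ suc) (≡.sym (Fin.toℕ-fromℕ< t<m))
        (mixed-nonneg d (suc t) (≡.trans (ℕ.+-suc d t) eq))))
      where
      t<m : t < m
      t<m = ≡.subst (t <_) eq (ℕ.m<n+m t z<s)

    bidiagonalRows-nonneg : ∀ rows → StrictlyIncreasing rows →
      NonNeg (Φ (λ i j → bidiagonalRows a Y (rows i) (cols j)))
    bidiagonalRows-nonneg rows rows↑ = NonNeg-resp (Φ-cong (λ i j → reflexive (mixed-≮ {0} rows i j λ ())))
      (mixed-nonneg m 0 (ℕ.+-identityʳ m) rows rows↑)

  TPr-bidiagonalRows : ∀ r X a → (∀ n → NonNeg (a n)) → TPr r X → TPr r (bidiagonalRows a X)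
  TPr-bidiagonalRows r X a a≥0 X-TPr m m≤r rows cols rows↑ cols↑ =
    BidiagonalRowMinors.bidiagonalRows-nonneg det det-cong det-linear-row det-adjacent-rows
      X a a≥0 cols (λ rows′ rows′↑ → X-TPr m m≤r rows′ cols rows′↑ cols↑) rows rows↑

  -- column operations on X are row operations on flip X, whose minors are taken by det ∘ flip
  TPr-bidiagonalCols : ∀ r X a → (∀ n → NonNeg (a n)) → TPr r X → TPr r (bidiagonalCols a X)
  TPr-bidiagonalCols r X a a≥0 X-TPr m m≤r rows cols rows↑ cols↑ =
    BidiagonalRowMinors.bidiagonalRows-nonneg (det ∘ flip)
      (λ M≈N → det-cong (λ i j → M≈N j i))
      (λ M U V b k M≈U V≈U Mₖ≈ → det-linear-col (flip M) (flip U) (flip V) b k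
                                    (λ i j → M≈U j i) (λ i j → V≈U j i) Mₖ≈)
      (λ M adj Mx≈My → det-adjacent-cols (flip M) adj Mx≈My)
      (flip X) a a≥0 rows (λ cols′ cols′↑ → X-TPr m m≤r rows cols′ rows↑ cols′↑) cols cols↑

module BinomialTransform {c ℓ₁ ℓ₂} (R : OrderedCommutativeRing c ℓ₁ ℓ₂) where
  open import Data.Nat using (_<_)
  open PolyDefs R
  open PolynomialRing R using (polyRing)
  open CommutativeRing polyRing hiding (zero)
  open RangeSum polyRing
  open import Algebra.Solver.Ring.NaturalCoefficients.Default commutativeSemiring
  open import Relation.Binary.Reasoning.Setoid setoid

  binomialTerm : ℕ → (ℕ → Poly) → ℕ → Poly
  binomialTerm n s i = fromℕₚ (n C i) * s i * γ ^ₚ (n ∸ i)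

  γ-binomial : (ℕ → Poly) → ℕ → Poly
  γ-binomial s n = ∑ℕ (suc n) (binomialTerm n s)

  foldr-applyUpTo : ∀ (f : ℕ → Poly) g n →
    foldr (λ i acc → f i + acc) 0# (applyUpTo g n) ≡ ∑ℕ n (f ∘ g)
  foldr-applyUpTo f g zero    = ≡.refl
  foldr-applyUpTo f g (suc n) = ≡.cong (f (g 0) +_) (foldr-applyUpTo f (g ∘ suc) n)

  sumTo≡∑ℕ : ∀ n f → sumTo n f ≡ ∑ℕ (suc n) f
  sumTo≡∑ℕ n f = foldr-applyUpTo f (λ i → i) (suc n)

  binomialTransform≡γ-binomial : ∀ A n k → binomialTransform A n k ≡ γ-binomial (λ i → A i k) n
  binomialTransform≡γ-binomial A n k = sumTo≡∑ℕ n _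

  fromℕₚ-+ : ∀ a b → fromℕₚ (a ℕ.+ b) ≈ fromℕₚ a + fromℕₚ b
  fromℕₚ-+ zero    b = sym (+-identityˡ _)
  fromℕₚ-+ (suc a) b = trans (+-congˡ (fromℕₚ-+ a b)) (sym (+-assoc _ _ _))

  γ-binomial-cong : ∀ n {s s′} → (∀ i → s i ≈ s′ i) → γ-binomial s n ≈ γ-binomial s′ n
  γ-binomial-cong n s≈s′ = ∑ℕ-cong (suc n) (λ i → *-congʳ {γ ^ₚ (n ∸ i)} (*-congˡ {fromℕₚ (n C i)} (s≈s′ i)))

  γ-binomial-+ : ∀ n s s′ → γ-binomial (λ i → s i + s′ i) n ≈ γ-binomial s n + γ-binomial s′ n
  γ-binomial-+ n s s′ = trans (∑ℕ-cong (suc n) (λ i → split (fromℕₚ (n C i)) (s i) (s′ i) (γ ^ₚ (n ∸ i))))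
                              (∑ℕ-distrib-+ (suc n) (binomialTerm n s) (binomialTerm n s′))
    where
    split : ∀ b x y g → b * (x + y) * g ≈ b * x * g + b * y * g
    split = solve 4 (λ b x y g → b :* (x :+ y) :* g := b :* x :* g :+ b :* y :* g) refl

  γ-binomial-* : ∀ n a s → γ-binomial (λ i → a * s i) n ≈ a * γ-binomial s n
  γ-binomial-* n a s = trans (∑ℕ-cong (suc n) (λ i → pull (fromℕₚ (n C i)) a (s i) (γ ^ₚ (n ∸ i))))
                             (sym (*-distribˡ-∑ℕ (suc n) a (binomialTerm n s)))
    where
    pull : ∀ b a x g → b * (a * x) * g ≈ a * (b * x * g)
    pull = solve 4 (λ b a x g → b :* (a :* x) :* g := a :* (b :* x :* g)) refl

  γ-binomial-suc : ∀ n s → γ-binomial s (suc n) ≈ γ * γ-binomial s n + γ-binomial (s ∘ suc) n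
  γ-binomial-suc n s = begin
    W 0 + ∑ℕ (suc n) (binomialTerm (suc n) s ∘ suc)  ≈⟨ +-congˡ (∑ℕ-cong (suc n) pascal-rule) ⟩
    W 0 + ∑ℕ (suc n) (λ i → U i + W (suc i))         ≈⟨ +-congˡ (∑ℕ-distrib-+ (suc n) U (W ∘ suc)) ⟩
    W 0 + (∑ℕ (suc n) U + ∑ℕ (suc n) (W ∘ suc))      ≈⟨ +-congˡ (+-comm _ _) ⟩
    W 0 + (∑ℕ (suc n) (W ∘ suc) + ∑ℕ (suc n) U)      ≈⟨ +-assoc _ _ _ ⟨
    ∑ℕ (suc (suc n)) W + γ-binomial (s ∘ suc) n      ≈⟨ +-congʳ W-sum ⟩
    γ * γ-binomial s n + γ-binomial (s ∘ suc) n      ∎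
    where
    U = binomialTerm n (s ∘ suc)
    W : ℕ → Poly
    W i = fromℕₚ (n C i) * s i * γ ^ₚ (suc n ∸ i)

    pascal-rule : ∀ i → binomialTerm (suc n) s (suc i) ≈ U i + W (suc i)
    pascal-rule i = begin
      fromℕₚ (suc n C suc i) * s (suc i) * γ ^ₚ (n ∸ i)
        ≡⟨ ≡.cong (λ k → fromℕₚ k * s (suc i) * γ ^ₚ (n ∸ i)) (nCk+nC[k+1]≡[n+1]C[k+1] n i) ⟨
      fromℕₚ (n C i ℕ.+ n C suc i) * s (suc i) * γ ^ₚ (n ∸ i)
        ≈⟨ *-congʳ {γ ^ₚ (n ∸ i)} (*-congʳ {s (suc i)} (fromℕₚ-+ (n C i) (n C suc i))) ⟩
      (fromℕₚ (n C i) + fromℕₚ (n C suc i)) * s (suc i) * γ ^ₚ (n ∸ i)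
        ≈⟨ split (fromℕₚ (n C i)) (fromℕₚ (n C suc i)) (s (suc i)) (γ ^ₚ (n ∸ i)) ⟩
      U i + W (suc i) ∎
      where
      split : ∀ a b x g → (a + b) * x * g ≈ a * x * g + b * x * g
      split = solve 4 (λ a b x g → (a :+ b) :* x :* g := a :* x :* g :+ b :* x :* g) refl

    W-sum : ∑ℕ (suc (suc n)) W ≈ γ * γ-binomial s n
    W-sum = begin
      ∑ℕ (suc (suc n)) W                          ≈⟨ ∑ℕ-init-last (suc n) W ⟩
      ∑ℕ (suc n) W + W (suc n)                    ≈⟨ +-congˡ W-last ⟩
      ∑ℕ (suc n) W + 0#                           ≈⟨ +-identityʳ _ ⟩
      ∑ℕ (suc n) W                                ≈⟨ ∑ℕ-cong-< (suc n) W≈γ* ⟩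
      ∑ℕ (suc n) (λ i → γ * binomialTerm n s i)   ≈⟨ *-distribˡ-∑ℕ (suc n) γ (binomialTerm n s) ⟨
      γ * γ-binomial s n                          ∎
      where
      g = γ ^ₚ (n ∸ n)
      W-last : W (suc n) ≈ 0#
      W-last = begin
        fromℕₚ (n C suc n) * s (suc n) * g ≡⟨ ≡.cong (λ k → fromℕₚ k * s (suc n) * g) (k>n⇒nCk≡0 (ℕ.n<1+n n)) ⟩
        0# * s (suc n) * g                 ≈⟨ *-congʳ {g} (zeroˡ (s (suc n))) ⟩
        0# * g                             ≈⟨ zeroˡ g ⟩
        0#                                     ∎
      W≈γ* : ∀ i → i < suc n → W i ≈ γ * binomialTerm n s i
      W≈γ* i i≤n = begin
        fromℕₚ (n C i) * s i * γ ^ₚ (suc n ∸ i)   ≡⟨ ≡.cong (λ k → fromℕₚ (n C i) * s i * γ ^ₚ k) (ℕ.+-∸-assoc 1 (ℕ.s≤s⁻¹ i≤n)) ⟩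
        fromℕₚ (n C i) * s i * (γ * γ ^ₚ (n ∸ i)) ≈⟨ x∙yz≈y∙xz (fromℕₚ (n C i) * s i) γ (γ ^ₚ (n ∸ i)) ⟩
        γ * binomialTerm n s i ∎
        where open import Algebra.Properties.CommutativeSemigroup *-commutativeSemigroup using (x∙yz≈y∙xz)

  rowGF-binomialTransform : ∀ A n →
    rowGF (binomialTransform A) n ≈ₛ sumToₛ n (λ i → (fromℕₚ (n C i) *ₚ (γ ^ₚ (n ∸ i))) ·ₛ rowGF A i)
  rowGF-binomialTransform A n k = begin
    binomialTransform A n k                                     ≡⟨ binomialTransform≡γ-binomial A n k ⟩
    ∑ℕ (suc n) (binomialTerm n (λ i → A i k))
      ≈⟨ ∑ℕ-cong (suc n) (λ i → xy∙z≈xz∙y (fromℕₚ (n C i)) (A i k) (γ ^ₚ (n ∸ i))) ⟩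
    ∑ℕ (suc n) (λ i → fromℕₚ (n C i) * γ ^ₚ (n ∸ i) * A i k)   ≡⟨ sumTo≡∑ℕ n _ ⟨
    sumToₛ n (λ i → (fromℕₚ (n C i) *ₚ (γ ^ₚ (n ∸ i))) ·ₛ rowGF A i) k ∎
    where open import Algebra.Properties.CommutativeSemigroup *-commutativeSemigroup using (xy∙z≈xz∙y)

  binomialTransform-lowerUnit : ∀ A → LowerUnit A → LowerUnit (binomialTransform A)
  binomialTransform-lowerUnit A (A₀₀≈1 , A-upper≈0) = A°₀₀≈1 , A°-upper≈0
    where
    A°₀₀≈1 : binomialTransform A 0 0 ≈ 1ₚ
    A°₀₀≈1 = begin
      binomialTransform A 0 0       ≡⟨ binomialTransform≡γ-binomial A 0 0 ⟩
      (1# + 0#) * A 0 0 * 1# + 0#   ≈⟨ solve 1 (λ a → (con 1 :+ con 0) :* a :* con 1 :+ con 0 := a) refl (A 0 0) ⟩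
      A 0 0                         ≈⟨ A₀₀≈1 ⟩
      1ₚ                            ∎
    A°-upper≈0 : ∀ n k → n < k → binomialTransform A n k ≈ 0ₚ
    A°-upper≈0 n k n<k = begin
      binomialTransform A n k                   ≡⟨ binomialTransform≡γ-binomial A n k ⟩
      ∑ℕ (suc n) (binomialTerm n (λ i → A i k)) ≈⟨ ∑ℕ-zero (suc n) term≈0 ⟩
      0#                                        ∎
      where
      term≈0 : ∀ i → i < suc n → binomialTerm n (λ i → A i k) i ≈ 0#
      term≈0 i i≤n = begin
        fromℕₚ (n C i) * A i k * γ ^ₚ (n ∸ i) ≈⟨ *-congʳ {γ ^ₚ (n ∸ i)} (*-congˡ {fromℕₚ (n C i)}
                                                    (A-upper≈0 i k (ℕ.≤-<-trans (ℕ.s≤s⁻¹ i≤n) n<k))) ⟩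
        fromℕₚ (n C i) * 0# * γ ^ₚ (n ∸ i)    ≈⟨ solve 2 (λ b g → b :* con 0 :* g := con 0) refl (fromℕₚ (n C i)) (γ ^ₚ (n ∸ i)) ⟩
        0#                                    ∎

  triStep-cong : ∀ r s t {X Y} n k → (∀ k → X n k ≈ Y n k) → triStep r s t X n k ≈ triStep r s t Y n k
  triStep-cong r s t n zero    X≈Y = +-cong (*-congˡ {s 0} (X≈Y 0)) (*-congˡ {t 1} (X≈Y 1))
  triStep-cong r s t n (suc k) X≈Y = +-cong (+-cong (*-congˡ {r k} (X≈Y k)) (*-congˡ {s (suc k)} (X≈Y (suc k))))
                                            (*-congˡ {t (suc (suc k))} (X≈Y (suc (suc k))))

  triStep-γ+ : ∀ r s t X n k → triStep r (λ k → γ + s k) t X n k ≈ γ * X n k + triStep r s t X n k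
  triStep-γ+ r s t X n zero    = solve 5 (λ g a b x y → (g :+ a) :* x :+ b :* y := g :* x :+ (a :* x :+ b :* y))
                                         refl γ (s 0) (t 1) (X n 0) (X n 1)
  triStep-γ+ r s t X n (suc k) = solve 7 (λ g a b c x y z → a :* x :+ (g :+ b) :* y :+ c :* z
                                                         := g :* y :+ (a :* x :+ b :* y :+ c :* z))
                                         refl γ (r k) (s (suc k)) (t (suc (suc k))) (X n k) (X n (suc k)) (X n (suc (suc k)))

  γ-binomial-triStep : ∀ r s t A n k →
    γ-binomial (λ i → triStep r s t A i k) n ≈ triStep r s t (binomialTransform A) n k
  γ-binomial-triStep r s t A n k = trans (commute k)
    (triStep-cong r s t n k (λ k → reflexive (≡.sym (binomialTransform≡γ-binomial A n k))))
    where
    col : ℕ → ℕ → Poly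
    col k i = A i k
    commute : ∀ k → γ-binomial (λ i → triStep r s t A i k) n ≈ triStep r s t (λ i k → γ-binomial (col k) i) n k
    commute zero = trans (γ-binomial-+ n (λ i → s 0 * A i 0) (λ i → t 1 * A i 1))
                         (+-cong (γ-binomial-* n (s 0) (col 0)) (γ-binomial-* n (t 1) (col 1)))
    commute (suc k) =
      trans (γ-binomial-+ n (λ i → r k * A i k + s (suc k) * A i (suc k)) (λ i → t (suc (suc k)) * A i (suc (suc k))))
      (+-cong (trans (γ-binomial-+ n (λ i → r k * A i k) (λ i → s (suc k) * A i (suc k)))
                     (+-cong (γ-binomial-* n (r k) (col k)) (γ-binomial-* n (s (suc k)) (col (suc k)))))
              (γ-binomial-* n (t (suc (suc k))) (col (suc (suc k)))))

  binomialTransform-triRec : ∀ r s t A → TriRec r s t A → TriRec r (λ k → γ + s k) t (binomialTransform A)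
  binomialTransform-triRec r s t A A-rec n k = begin
    A° (suc n) k                                                  ≡⟨ binomialTransform≡γ-binomial A (suc n) k ⟩
    γ-binomial (λ i → A i k) (suc n)                              ≈⟨ γ-binomial-suc n (λ i → A i k) ⟩
    γ * γ-binomial (λ i → A i k) n + γ-binomial (λ i → A (suc i) k) n
      ≈⟨ +-cong (*-congˡ {γ} (reflexive (≡.sym (binomialTransform≡γ-binomial A n k))))
                (γ-binomial-cong n (λ i → A-rec i k)) ⟩
    γ * A° n k + γ-binomial (λ i → triStep r s t A i k) n         ≈⟨ +-congˡ (γ-binomial-triStep r s t A n k) ⟩
    γ * A° n k + triStep r s t A° n k                             ≈⟨ triStep-γ+ r s t A° n k ⟨
    triStep r (λ k → γ + s k) t A° n k                            ∎
    where
    A° = binomialTransform A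

module PascalFactorization {c ℓ₁ ℓ₂} (R : OrderedCommutativeRing c ℓ₁ ℓ₂) where
  open import Data.Nat using (_<_; _≤_)
  open PolyDefs R
  open PolynomialRing R using (polyRing)
  open CommutativeRing polyRing hiding (zero)
  open NonNegativity R using (NonNeg-0ₚ; NonNeg-γ)
  open Bidiagonal R
  open TotalPositivity R using (TPr-bidiagonalRows; TPr-bidiagonalCols)
  open BinomialTransform R using (γ-binomial; γ-binomial-suc; γ-binomial-cong)
  open import Algebra.Solver.Ring.NaturalCoefficients.Default commutativeSemiring
  open import Relation.Binary.Reasoning.Setoid setoid

  pascal : (ℕ → Poly) → ℕ → Poly
  pascal = bidiagonal (λ _ → γ)

  pascal^ : ℕ → (ℕ → Poly) → ℕ → Poly
  pascal^ zero    s = s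
  pascal^ (suc M) s = pascal (pascal^ M s)

  pascal^-cong : ∀ M {s s′} → (∀ t → s t ≈ s′ t) → ∀ t → pascal^ M s t ≈ pascal^ M s′ t
  pascal^-cong zero    s≈s′ t       = s≈s′ t
  pascal^-cong (suc M) s≈s′ zero    = pascal^-cong M s≈s′ zero
  pascal^-cong (suc M) s≈s′ (suc t) = +-cong (pascal^-cong M s≈s′ (suc t)) (*-congˡ {γ} (pascal^-cong M s≈s′ t))

  pascal^-+ : ∀ m n s → pascal^ m (pascal^ n s) ≡ pascal^ (m ℕ.+ n) s
  pascal^-+ zero    n s = ≡.refl
  pascal^-+ (suc m) n s = ≡.cong pascal (pascal^-+ m n s)

  pascal^-shift : ∀ M t d s → M ≤ t → pascal^ M (λ u → s (u ℕ.+ d)) t ≈ pascal^ M s (t ℕ.+ d)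
  pascal^-shift zero    t       d s M≤t       = refl
  pascal^-shift (suc M) (suc t) d s (s≤s M≤t) =
    +-cong (pascal^-shift M (suc t) d s (ℕ.m≤n⇒m≤1+n M≤t)) (*-congˡ {γ} (pascal^-shift M t d s M≤t))

  pascal^-window : ∀ M t s → M ≤ t → pascal^ M s t ≈ γ-binomial (λ i → s (t ∸ M ℕ.+ i)) M
  pascal^-window zero t s _ = begin
    s t                                       ≡⟨ ≡.cong s (ℕ.+-identityʳ t) ⟨
    s (t ℕ.+ 0)                               ≈⟨ solve 1 (λ x → (con 1 :+ con 0) :* x :* con 1 :+ con 0 := x) refl (s (t ℕ.+ 0)) ⟨
    γ-binomial (λ i → s (t ℕ.+ i)) 0          ∎
  pascal^-window (suc M) (suc t) s (s≤s M≤t) = begin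
    pascal^ M s (suc t) + γ * pascal^ M s t
      ≈⟨ +-cong (pascal^-window M (suc t) s (ℕ.m≤n⇒m≤1+n M≤t)) (*-congˡ {γ} (pascal^-window M t s M≤t)) ⟩
    γ-binomial (λ i → s (suc t ∸ M ℕ.+ i)) M + γ * γ-binomial w M
      ≈⟨ +-congʳ (γ-binomial-cong M (λ i → reflexive (≡.cong s (slide i)))) ⟩
    γ-binomial (w ∘ suc) M + γ * γ-binomial w M  ≈⟨ +-comm _ _ ⟩
    γ * γ-binomial w M + γ-binomial (w ∘ suc) M  ≈⟨ γ-binomial-suc M w ⟨
    γ-binomial w (suc M)                         ∎
    where
    w : ℕ → Poly
    w i = s (t ∸ M ℕ.+ i)
    slide : ∀ i → suc t ∸ M ℕ.+ i ≡ t ∸ M ℕ.+ suc i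
    slide i = ≡.trans (≡.cong (ℕ._+ i) (ℕ.+-∸-assoc 1 M≤t)) (≡.sym (ℕ.+-suc (t ∸ M) i))

  pascal^-diagonal : ∀ n s → pascal^ n s n ≈ γ-binomial s n
  pascal^-diagonal n s = trans (pascal^-window n n s ℕ.≤-refl)
    (γ-binomial-cong n (λ i → reflexive (≡.cong (λ u → s (u ℕ.+ i)) (ℕ.n∸n≡0 n))))

  γ≥ : ℕ → ℕ → Poly
  γ≥ j n with j ≤? n
  ... | yes _ = γ
  ... | no  _ = 0ₚ

  γ≥-nonneg : ∀ j n → NonNeg (γ≥ j n)
  γ≥-nonneg j n with j ≤? n
  ... | yes _ = NonNeg-γ
  ... | no  _ = NonNeg-0ₚ

  γ≥-≤ : ∀ {j n} → j ≤ n → γ≥ j n ≡ γ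
  γ≥-≤ {j} {n} j≤n with j ≤? n
  ... | yes _  = ≡.refl
  ... | no j≰n = contradiction j≤n j≰n

  γ≥-> : ∀ {j n} → n < j → γ≥ j n ≡ 0ₚ
  γ≥-> {j} {n} n<j with j ≤? n
  ... | yes j≤n = contradiction j≤n (ℕ.<⇒≱ n<j)
  ... | no _    = ≡.refl

  -- pascalFactors K = E_K ∘ ⋯ ∘ E_1, where E_j adds γ times row n - 1 to row n for n ≥ j: a product
  -- of bidiagonal matrices with nonnegative subdiagonals which, on the rows n ≤ K, performs n Pascal
  -- steps and hence the γ-binomial transform
  pascalFactors : ℕ → (ℕ → Poly) → ℕ → Poly
  pascalFactors zero    s = s
  pascalFactors (suc K) s = bidiagonal (γ≥ (suc K)) (pascalFactors K s)

  pascalFactors-≥ : ∀ K n s → K ≤ n → pascalFactors K s n ≈ pascal^ K s n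
  pascalFactors-≥ zero    n       s _         = refl
  pascalFactors-≥ (suc K) (suc n) s (s≤s K≤n) = +-cong (pascalFactors-≥ K (suc n) s (ℕ.m≤n⇒m≤1+n K≤n))
    (*-cong (reflexive (γ≥-≤ (s≤s K≤n))) (pascalFactors-≥ K n s K≤n))

  pascalFactors-≤ : ∀ K n s → n ≤ K → pascalFactors K s n ≈ pascal^ n s n
  pascalFactors-≤ zero    zero    s _   = refl
  pascalFactors-≤ (suc K) zero    s _   = pascalFactors-≤ K zero s z≤n
  pascalFactors-≤ (suc K) (suc n) s n≤K with ℕ.m≤n⇒m<n∨m≡n n≤K
  ... | inj₁ n<K = begin
    pascalFactors K s (suc n) + γ≥ (suc K) (suc n) * pascalFactors K s n
      ≡⟨ ≡.cong (λ g → pascalFactors K s (suc n) + g * pascalFactors K s n) (γ≥-> n<K) ⟩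
    pascalFactors K s (suc n) + 0# * pascalFactors K s n
      ≈⟨ solve 2 (λ x y → x :+ con 0 :* y := x) refl (pascalFactors K s (suc n)) (pascalFactors K s n) ⟩
    pascalFactors K s (suc n)           ≈⟨ pascalFactors-≤ K (suc n) s (ℕ.s≤s⁻¹ n<K) ⟩
    pascal^ (suc n) s (suc n)           ∎
  ... | inj₂ ≡.refl = +-cong (pascalFactors-≥ K (suc K) s (ℕ.n≤1+n K))
    (*-cong (reflexive (γ≥-≤ {suc K} ℕ.≤-refl)) (pascalFactors-≥ K K s ℕ.≤-refl))

  pascalFactors-γ-binomial : ∀ K n s → n ≤ K → pascalFactors K s n ≈ γ-binomial s n
  pascalFactors-γ-binomial K n s n≤K = trans (pascalFactors-≤ K n s n≤K) (pascal^-diagonal n s)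

  pascalRows : ℕ → Array → Array
  pascalRows K X n k = pascalFactors K (λ t → X t k) n

  pascalCols : ℕ → Array → Array
  pascalCols K X n k = pascalFactors K (X n) k

  TPr-pascalRows : ∀ r K X → TPr r X → TPr r (pascalRows K X)
  TPr-pascalRows r zero    X X-TPr = X-TPr
  TPr-pascalRows r (suc K) X X-TPr =
    TPr-bidiagonalRows r (pascalRows K X) (γ≥ (suc K)) (γ≥-nonneg (suc K)) (TPr-pascalRows r K X X-TPr)

  TPr-pascalCols : ∀ r K X → TPr r X → TPr r (pascalCols K X)
  TPr-pascalCols r zero    X X-TPr = X-TPr
  TPr-pascalCols r (suc K) X X-TPr =
    TPr-bidiagonalCols r (pascalCols K X) (γ≥ (suc K)) (γ≥-nonneg (suc K)) (TPr-pascalCols r K X X-TPr)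

  -- row operations on a Hankel array act on the underlying sequence, and so do column operations
  pascal-Hankel : ∀ K a {n k} → n ≤ K → k ≤ K → pascalCols K (pascalRows K (Hankel a)) n k ≈ γ-binomial a (n ℕ.+ k)
  pascal-Hankel K a {n} {k} n≤K k≤K = begin
    pascalFactors K (λ j → pascalFactors K (λ t → a (t ℕ.+ j)) n) k
      ≈⟨ pascalFactors-≤ K k (λ j → pascalFactors K (λ t → a (t ℕ.+ j)) n) k≤K ⟩
    pascal^ k (λ j → pascalFactors K (λ t → a (t ℕ.+ j)) n) k
      ≈⟨ pascal^-cong k (λ j → pascalFactors-≤ K n (λ t → a (t ℕ.+ j)) n≤K) k ⟩
    pascal^ k (λ j → pascal^ n (λ t → a (t ℕ.+ j)) n) k
      ≈⟨ pascal^-cong k (λ j → trans (pascal^-shift n n j a ℕ.≤-refl)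
                                     (reflexive (≡.cong (pascal^ n a) (ℕ.+-comm n j)))) k ⟩
    pascal^ k (λ j → pascal^ n a (j ℕ.+ n)) k
      ≈⟨ pascal^-shift k k n (pascal^ n a) ℕ.≤-refl ⟩
    pascal^ k (pascal^ n a) (k ℕ.+ n)   ≡⟨ ≡.cong (λ s → s (k ℕ.+ n)) (pascal^-+ k n a) ⟩
    pascal^ (k ℕ.+ n) a (k ℕ.+ n)       ≡⟨ ≡.cong (λ M → pascal^ M a M) (ℕ.+-comm k n) ⟩
    pascal^ (n ℕ.+ k) a (n ℕ.+ k)       ≈⟨ pascal^-diagonal (n ℕ.+ k) a ⟩
    γ-binomial a (n ℕ.+ k)              ∎

upperBound : ∀ {m} → (Fin m → ℕ) → ℕ
upperBound {ℕ.zero} f = 0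
upperBound {ℕ.suc m} f = f zero ℕ.⊔ upperBound (f ∘ suc)

upperBound-≥ : ∀ {m} (f : Fin m → ℕ) i → f i ℕ.≤ upperBound f
upperBound-≥ f zero    = ℕ.m≤m⊔n (f zero) _
upperBound-≥ f (suc i) = ℕ.≤-trans (upperBound-≥ (f ∘ suc) i) (ℕ.m≤n⊔m (f zero) _)

module BinomialPositivity {c ℓ₁ ℓ₂} (R : OrderedCommutativeRing c ℓ₁ ℓ₂) where
  open PolyDefs R
  open PolynomialRing R using (polyRing)
  open CommutativeRing polyRing using (trans; reflexive)
  open NonNegativity R using (NonNeg-resp)
  open Determinants R using (det-cong)
  open BinomialTransform R using (binomialTransform≡γ-binomial)
  open PascalFactorization R

  TPr-binomialTransform : ∀ r A → TPr r A → TPr r (binomialTransform A)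
  TPr-binomialTransform r A A-TPr m m≤r rows cols rows↑ cols↑ =
    NonNeg-resp (det-cong agree) (TPr-pascalRows r K A A-TPr m m≤r rows cols rows↑ cols↑)
    where
    K = upperBound rows
    agree : ∀ i j → pascalRows K A (rows i) (cols j) ≈ₚ binomialTransform A (rows i) (cols j)
    agree i j = trans (pascalFactors-γ-binomial K (rows i) (λ t → A t (cols j)) (upperBound-≥ rows i))
                      (reflexive (≡.sym (binomialTransform≡γ-binomial A (rows i) (cols j))))

  Stieltjes-binomialTransform : ∀ A → Stieltjes (λ n → A n 0) → Stieltjes (λ n → binomialTransform A n 0)
  Stieltjes-binomialTransform A H-TP m rows cols rows↑ cols↑ =
    NonNeg-resp (det-cong agree)
      (TPr-pascalCols m K (pascalRows K (Hankel a)) (TPr-pascalRows m K (Hankel a) (λ m′ _ → H-TP m′))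
                      m ℕ.≤-refl rows cols rows↑ cols↑)
    where
    a : ℕ → Poly
    a n = A n 0
    K = upperBound rows ℕ.+ upperBound cols
    agree : ∀ i j → pascalCols K (pascalRows K (Hankel a)) (rows i) (cols j) ≈ₚ binomialTransform A (rows i ℕ.+ cols j) 0
    agree i j = trans (pascal-Hankel K a (ℕ.≤-trans (upperBound-≥ rows i) (ℕ.m≤m+n _ _))
                                         (ℕ.≤-trans (upperBound-≥ cols j) (ℕ.m≤n+m _ _)))
                      (reflexive (≡.sym (binomialTransform≡γ-binomial A (rows i ℕ.+ cols j) 0)))

-- the hypotheses that the entries lie in ℝ[x] are not needed
proposition2p5 : ∀ {c ℓ₁ ℓ₂} (R : OrderedCommutativeRing c ℓ₁ ℓ₂) →
    let open PolyDefs R in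
    (A : Array) → (∀ n k → InRx (A n k)) →
    let A° = binomialTransform A in
    -- (i)
    (∀ (r : ℕ) → TPr r A → TPr r A°)
    -- (ii)
    × (∀ (n : ℕ) → rowGF A° n ≈ₛ sumToₛ n (λ i → (fromℕₚ (n C i) *ₚ (γ ^ₚ (n ∸ i))) ·ₛ rowGF A i))
    -- (iii)
    × (∀ (r s t : ℕ → Poly) → (∀ k → InRx (r k)) → (∀ k → InRx (s k)) → (∀ k → InRx (t k)) →
         LowerUnit A → TriRec r s t A →
         LowerUnit A° × TriRec r (λ k → γ +ₚ s k) t A°)
    -- (iv)
    × (Stieltjes (λ n → A n 0) → Stieltjes (λ n → A° n 0))
proposition2p5 R A _ =
    (λ r → TPr-binomialTransform r A)
  , rowGF-binomialTransform A
  , (λ r s t _ _ _ A-unit A-rec → binomialTransform-lowerUnit A A-unit , binomialTransform-triRec r s t A A-rec)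
  , Stieltjes-binomialTransform A
  where
  open BinomialTransform R
  open BinomialPositivity R
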